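{- Let $G$ be a finite simple undirected graph, let $V_k\subseteq V(G)$ be a vertex cover of $G$ with $|V_k|=k$, and let $M=M(G,V_k)$ be the graph obtained from $G$ by adding, for each non-empty subset $X\subseteq V_k$, a new vertex $M_X$ whose neighborhood is exactly $X$. Fix a partition of $V_k$ into three non-empty sets $A$, $P_1$, $P_2$. Then there are at most $2k$ free potential maximal cliques $\Omega$ of $M$ such that $P(\Omega)=\{A,P_1,P_2\}$, i.e., such that $V_k\cap\Omega=A$ and the non-empty sets $V_k\cap C$, over connected components $C$ of $M\setminus\Omega$, are exactly $P_1$ and $P_2$.
   Context: A vertex cover is a vertex set meeting every edge. For $\Omega\subseteq V(M)$, $M\setminus\Omega$ is the subgraph induced by $V(M)\setminus\Omega$. A triangulation of $M$ is a chordal graph on $V(M)$ containing $E(M)$; it is minimal if no triangulation has an edge set that is a proper subset of its edge set. A potential maximal clique (PMC) of $M$ is a maximal clique of some minimal triangulation of $M$. A PMC $\Omega$ is free if every vertex of $\Omega$ is adjacent to some vertex of $V(M)\setminus\Omega$. For a PMC $\Omega$ of $M$, $P(\Omega)$ is the partition of $V_k$ whose parts are $V_k\cap\Omega$ (if non-empty) together with the non-empty sets $V_k\cap C$ for the connected components $C$ of $M\setminus\Omega$. -}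

module Defs where

open import Data.Nat using (ℕ; zero; suc; _≤_)
open import Data.Bool using (Bool; true; false; T; not)
open import Data.Fin using (Fin; toℕ)
open import Data.Fin.Subset using (Subset; _∈_; _⊆_; Nonempty)
open import Data.Fin.Subset.Properties using (nonempty?; _⊆?_)
open import Data.Vec using (lookup)
open import Data.Product using (Σ; ∃; ∃-syntax; _×_; _,_)
open import Data.Sum using (_⊎_; inj₁; inj₂)
open import Relation.Nullary using (¬_)
open import Relation.Nullary.Decidable using (True)
open import Relation.Binary.PropositionalEquality using (_≡_; _≢_; refl)
open import Function.Definitions using (Injective)

record Graph (V : Set) : Set where
  field
    adj    : V → V → Bool
    sym    : ∀ u v → adj u v ≡ adj v u
    irrefl : ∀ v → adj v v ≡ false
open Graph public

VSet : Set → Set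
VSet V = V → Bool

_⊆ᴱ_ : ∀ {V} → Graph V → Graph V → Set
H₁ ⊆ᴱ H₂ = ∀ u v → T (adj H₁ u v) → T (adj H₂ u v)

_⊂ᴱ_ : ∀ {V} → Graph V → Graph V → Set
H₁ ⊂ᴱ H₂ = (H₁ ⊆ᴱ H₂) × ∃[ u ] ∃[ v ] (T (adj H₂ u v) × ¬ T (adj H₁ u v))

-- Chordality: every cycle of length ≥ 4 has a chord.
-- A cycle of length suc m is an injective c : Fin (suc m) → V with
-- c i adjacent to c (i+1) for all i, and c m adjacent to c 0.

CycConsec : ℕ → ℕ → ℕ → Set
CycConsec m a b = (suc a ≡ b) ⊎ (suc b ≡ a) ⊎ (a ≡ 0 × b ≡ m) ⊎ (b ≡ 0 × a ≡ m)

IsCycle : ∀ {V} → Graph V → (m : ℕ) → (Fin (suc m) → V) → Set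
IsCycle H m c =
  Injective _≡_ _≡_ c ×
  (∀ (i j : Fin (suc m)) → CycConsec m (toℕ i) (toℕ j) → T (adj H (c i) (c j)))

HasChord : ∀ {V} → Graph V → (m : ℕ) → (Fin (suc m) → V) → Set
HasChord H m c = ∃[ i ] ∃[ j ]
  (toℕ i ≢ toℕ j × ¬ CycConsec m (toℕ i) (toℕ j) × T (adj H (c i) (c j)))

Chordal : ∀ {V} → Graph V → Set
Chordal H = ∀ (m : ℕ) (c : Fin (suc m) → _) → 3 ≤ m → IsCycle H m c → HasChord H m c

IsTriangulation : ∀ {V} → Graph V → Graph V → Set
IsTriangulation M H = Chordal H × (M ⊆ᴱ H)

IsMinimalTriangulation : ∀ {V} → Graph V → Graph V → Set
IsMinimalTriangulation {V} M H =
  IsTriangulation M H × (∀ (H' : Graph V) → IsTriangulation M H' → ¬ (H' ⊂ᴱ H))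

IsClique : ∀ {V} → Graph V → VSet V → Set
IsClique H Ω = ∀ u v → T (Ω u) → T (Ω v) → u ≢ v → T (adj H u v)

IsMaximalClique : ∀ {V} → Graph V → VSet V → Set
IsMaximalClique {V} H Ω =
  IsClique H Ω ×
  (∀ (Ω' : VSet V) → IsClique H Ω' → (∀ v → T (Ω v) → T (Ω' v)) → ∀ v → T (Ω' v) → T (Ω v))

IsPMC : ∀ {V} → Graph V → VSet V → Set
IsPMC {V} M Ω = ∃[ H ] (IsMinimalTriangulation M H × IsMaximalClique H Ω)

IsFree : ∀ {V} → Graph V → VSet V → Set
IsFree M Ω = ∀ v → T (Ω v) → ∃[ w ] (T (not (Ω w)) × T (adj M v w))

data Walk {V : Set} (M : Graph V) (Ω : VSet V) : V → V → Set where
  here : ∀ {u} → T (not (Ω u)) → Walk M Ω u u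
  step : ∀ {u w v} → T (not (Ω u)) → T (adj M u w) → Walk M Ω w v → Walk M Ω u v

IsComponent : ∀ {V} → Graph V → VSet V → VSet V → Set
IsComponent M Ω C =
  (∃[ v ] T (C v)) ×
  (∀ v → T (C v) → T (not (Ω v))) ×
  (∀ u v → T (C u) → T (C v) → Walk M Ω u v) ×
  (∀ u v → T (C u) → T (not (Ω v)) → T (adj M u v) → T (C v))

IsVertexCover : ∀ {n} → Graph (Fin n) → Subset n → Set
IsVertexCover G S = ∀ u v → T (adj G u v) → (u ∈ S) ⊎ (v ∈ S)

-- vertices M_X, one for each non-empty X ⊆ V_k
-- (the side condition lives in a proof-irrelevant type `True`)
MXVertex : ∀ {n} → Subset n → Set
MXVertex {n} Vk = Σ (Subset n) λ X → True (nonempty? X) × True (X ⊆? Vk)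

MVertex : ∀ {n} → Subset n → Set
MVertex {n} Vk = Fin n ⊎ MXVertex Vk

MAdj : ∀ {n} → Graph (Fin n) → (Vk : Subset n) → MVertex Vk → MVertex Vk → Bool
MAdj G Vk (inj₁ u) (inj₁ v) = adj G u v
MAdj G Vk (inj₁ u) (inj₂ (X , _)) = lookup X u
MAdj G Vk (inj₂ (X , _)) (inj₁ v) = lookup X v
MAdj G Vk (inj₂ _) (inj₂ _) = false

MAdj-sym : ∀ {n} (G : Graph (Fin n)) Vk u v → MAdj G Vk u v ≡ MAdj G Vk v u
MAdj-sym G Vk (inj₁ u) (inj₁ v) = sym G u v
MAdj-sym G Vk (inj₁ u) (inj₂ _) = refl
MAdj-sym G Vk (inj₂ _) (inj₁ v) = refl
MAdj-sym G Vk (inj₂ _) (inj₂ _) = refl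

MAdj-irrefl : ∀ {n} (G : Graph (Fin n)) Vk v → MAdj G Vk v v ≡ false
MAdj-irrefl G Vk (inj₁ v) = irrefl G v
MAdj-irrefl G Vk (inj₂ _) = refl

MGraph : ∀ {n} → Graph (Fin n) → (Vk : Subset n) → Graph (MVertex Vk)
MGraph G Vk = record { adj = MAdj G Vk ; sym = MAdj-sym G Vk ; irrefl = MAdj-irrefl G Vk }

TraceEq : ∀ {n} {Vk : Subset n} → Subset n → VSet (MVertex Vk) → Subset n → Set
TraceEq {n} Vk C P = ∀ (i : Fin n) → ((i ∈ Vk × T (C (inj₁ i))) → i ∈ P) × (i ∈ P → (i ∈ Vk × T (C (inj₁ i))))

PartitionIs : ∀ {n} → Graph (Fin n) → (Vk : Subset n) → VSet (MVertex Vk) →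
              Subset n → Subset n → Subset n → Set
PartitionIs {n} G Vk Ω A P₁ P₂ =
  TraceEq {Vk = Vk} Vk Ω A ×
  (∀ C → IsComponent (MGraph G Vk) Ω C →
     (∃[ i ] (i ∈ Vk × T (C (inj₁ i)))) →
     TraceEq {Vk = Vk} Vk C P₁ ⊎ TraceEq {Vk = Vk} Vk C P₂) ×
  (∃[ C ] (IsComponent (MGraph G Vk) Ω C × TraceEq {Vk = Vk} Vk C P₁)) ×
  (∃[ C ] (IsComponent (MGraph G Vk) Ω C × TraceEq {Vk = Vk} Vk C P₂))

DistinctVSet : ∀ {V} → VSet V → VSet V → Set
DistinctVSet Ω Ω' = ∃[ v ] (Ω v ≢ Ω' v)

-- Let H be a minimal triangulation of M with maximal clique Ω. Deleting edges of H and invoking minimality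
-- shows that no component of M ∖ Ω is full (adjacent to all of Ω), and that any two non-adjacent vertices of Ω
-- have a common adjacent component. Now let Ω be free with P(Ω) = {A, P₁, P₂}, and let C₁, C₂ be the
-- components tracing P₁, P₂. Some a ∈ A is non-adjacent to C₁ or to C₂, for otherwise one of them would be
-- full. Given the side i and such an a, Ω is determined: Ω ∩ V_k = A, and a vertex v outside V_k lies in Ω
-- iff N(v) meets P_i and, moreover, meets the other part or contains a. So Ω ↦ (i, a) is injective, and
-- there are at most 2|A| ≤ 2k such Ω.

module Submission where

open import Defs hiding (sym)
open import Data.Bool using (Bool; true; false; T; not; _∧_; _∨_)
open import Data.Bool.Properties using (T?; T-∧; T-∨; ∨-comm; T-irrelevant)
import Data.Bool.Properties as Bool
open import Data.Empty using (⊥-elim)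
import Data.Empty as Empty
open import Data.Fin as Fin using (Fin; toℕ; fromℕ<)
open import Data.Fin.Properties using (toℕ-injective; toℕ<n; toℕ-fromℕ<; any?)
open import Data.Nat as ℕ using (ℕ; zero; suc; _≤_; _<_; z≤n; s≤s; _∸_; _+_; _*_)
open import Data.Nat.Properties hiding (_≟_)
open import Data.Product using (∃; ∃-syntax; _×_; _,_; proj₁; proj₂)
import Data.Product.Properties as Product
open import Data.Sum using (_⊎_; inj₁; inj₂; [_,_])
import Data.Sum.Properties as Sum
open import Data.Vec using (tabulate; []; _∷_)
import Data.Vec.Properties as Vec
open import Data.Fin.Subset using (Subset; _∈_; _⊆_; Nonempty; _∩_; _∪_; ⊥; ⁅_⁆; _-_; ∣_∣)
open import Data.Fin.Subset.Properties using (x∈⁅y⁆⇒x≡y; x∈p⇒∣p-x∣<∣p∣; x∈p∧x∉q⇒x∈p─q; nonempty?; _⊆?_; _∈?_; ∉⊥; x∈p∩q⁺; x∈p∩q⁻; x∈p∪q⁺; x∈p∪q⁻; x∈⁅x⁆; ∩-comm; ∪-comm; p⊆q⇒∣p∣≤∣q∣; p⊆p∪q)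
open import Data.List using (List; []; _∷_; _++_; length; lookup; filter; map; concatMap; allFin)
open import Data.List.Membership.Propositional using (lose) renaming (_∈_ to _∈ˡ_)
open import Data.List.Membership.Propositional.Properties using (∈-lookup; ∈-filter⁺; ∈-++⁺ˡ; ∈-++⁺ʳ; ∈-map⁺; ∈-concatMap⁺; ∈-allFin)
open import Data.List.Relation.Unary.All as All using (All; []; _∷_)
open import Data.List.Relation.Unary.All.Properties using (¬Any⇒All¬; all-filter)
open import Data.List.Relation.Unary.Any as Any using (Any; here; there)
open import Data.List.Relation.Unary.AllPairs using (AllPairs; []; _∷_)
open import Data.Unit using (⊤; tt)
open import Function using (_∘_)
open import Function.Bundles using (Equivalence)
open import Relation.Nullary using (¬_; Dec; yes; no; ¬?)
open import Relation.Nullary.Decidable using (decidable-stable; isYes; toWitness; fromWitness; _×-dec_; _⊎-dec_)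
open import Relation.Binary.Definitions using (DecidableEquality; tri<; tri≈; tri>)
open import Relation.Binary.PropositionalEquality using (_≡_; _≢_; refl; sym; trans; cong; cong₂; subst; subst₂)

module _ {x y : Bool} where

  T-∧-intro : T x → T y → T (x ∧ y)
  T-∧-intro p q = Equivalence.from T-∧ (p , q)

  T-∧-elimˡ : T (x ∧ y) → T x
  T-∧-elimˡ = proj₁ ∘ Equivalence.to T-∧

  T-∧-elimʳ : T (x ∧ y) → T y
  T-∧-elimʳ = proj₂ ∘ Equivalence.to T-∧

  T-∨-introˡ : T x → T (x ∨ y)
  T-∨-introˡ = Equivalence.from T-∨ ∘ inj₁

  T-∨-introʳ : T y → T (x ∨ y)
  T-∨-introʳ = Equivalence.from T-∨ ∘ inj₂

  T-∨-elim : T (x ∨ y) → T x ⊎ T y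
  T-∨-elim = Equivalence.to T-∨

T-not-intro : ∀ {x} → ¬ T x → T (not x)
T-not-intro {true}  ¬t = ¬t _
T-not-intro {false} _  = _

T-not-elim : ∀ {x} → T (not x) → ¬ T x
T-not-elim {true} ()

T-stable : ∀ {x} → ¬ ¬ T x → T x
T-stable {x} = decidable-stable (T? x)

T-extensional : ∀ {x y} → (T x → T y) → (T y → T x) → x ≡ y
T-extensional {true}  {true}  _ _ = refl
T-extensional {true}  {false} f _ = ⊥-elim (f _)
T-extensional {false} {true}  _ g = ⊥-elim (g _)
T-extensional {false} {false} _ _ = refl

-- Cycles, chords and induced paths

CycConsec-sym : ∀ {m} a b → CycConsec m a b → CycConsec m b a
CycConsec-sym a b (inj₁ e)                 = inj₂ (inj₁ e)
CycConsec-sym a b (inj₂ (inj₁ e))          = inj₁ e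
CycConsec-sym a b (inj₂ (inj₂ (inj₁ p)))   = inj₂ (inj₂ (inj₂ p))
CycConsec-sym a b (inj₂ (inj₂ (inj₂ p)))   = inj₂ (inj₂ (inj₁ p))

module CyclicOrder {m : ℕ} where

  toℕ≤m : (i : Fin (suc m)) → toℕ i ≤ m
  toℕ≤m i = ≤-pred (toℕ<n i)

  private
    suc<1+m : ∀ (i : Fin (suc m)) → toℕ i ≢ m → suc (toℕ i) < suc m
    suc<1+m i i≢m = s≤s (≤∧≢⇒< (toℕ≤m i) i≢m)

  next : Fin (suc m) → Fin (suc m)
  next i with toℕ i ℕ.≟ m
  ... | yes _   = Fin.zero
  ... | no i≢m = fromℕ< (suc<1+m i i≢m)

  next-last : ∀ i → toℕ i ≡ m → next i ≡ Fin.zero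
  next-last i i≡m with toℕ i ℕ.≟ m
  ... | yes _   = refl
  ... | no i≢m = ⊥-elim (i≢m i≡m)

  toℕ-next : ∀ i → toℕ i ≢ m → toℕ (next i) ≡ suc (toℕ i)
  toℕ-next i i≢m with toℕ i ℕ.≟ m
  ... | yes i≡m = ⊥-elim (i≢m i≡m)
  ... | no i≢m  = toℕ-fromℕ< (suc<1+m i i≢m)

  next-injective : ∀ i j → next i ≡ next j → i ≡ j
  next-injective i j e = by-cases (toℕ i ℕ.≟ m) (toℕ j ℕ.≟ m)
    where
    by-cases : Dec (toℕ i ≡ m) → Dec (toℕ j ≡ m) → i ≡ j
    by-cases (yes i≡m) (yes j≡m) = toℕ-injective (trans i≡m (sym j≡m))
    by-cases (yes i≡m) (no j≢m)  = ⊥-elim (0≢1+n (trans (cong toℕ (trans (sym (next-last i i≡m)) e)) (toℕ-next j j≢m)))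
    by-cases (no i≢m)  (yes j≡m) = ⊥-elim (0≢1+n (trans (cong toℕ (trans (sym (next-last j j≡m)) (sym e))) (toℕ-next i i≢m)))
    by-cases (no i≢m)  (no j≢m)  = toℕ-injective (suc-injective (trans (sym (toℕ-next i i≢m)) (trans (cong toℕ e) (toℕ-next j j≢m))))

  next-CycConsec : ∀ i → CycConsec m (toℕ i) (toℕ (next i))
  next-CycConsec i with toℕ i ℕ.≟ m
  ... | yes i≡m = inj₂ (inj₂ (inj₂ (refl , i≡m)))
  ... | no i≢m  = inj₁ (sym (toℕ-fromℕ< (suc<1+m i i≢m)))

  suc-toℕ⇒next : ∀ i j → suc (toℕ i) ≡ toℕ j → j ≡ next i
  suc-toℕ⇒next i j e = toℕ-injective (trans (sym e) (sym (toℕ-next i i≢m)))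
    where
    i≢m : toℕ i ≢ m
    i≢m i≡m = 1+n≰n (subst (λ z → suc z ≤ m) i≡m (subst (_≤ m) (sym e) (toℕ≤m j)))

  CycConsec⇒next : ∀ i j → CycConsec m (toℕ i) (toℕ j) → j ≡ next i ⊎ i ≡ next j
  CycConsec⇒next i j (inj₁ e)                          = inj₁ (suc-toℕ⇒next i j e)
  CycConsec⇒next i j (inj₂ (inj₁ e))                   = inj₂ (suc-toℕ⇒next j i e)
  CycConsec⇒next i j (inj₂ (inj₂ (inj₁ (i≡0 , j≡m)))) = inj₂ (trans (toℕ-injective i≡0) (sym (next-last j j≡m)))
  CycConsec⇒next i j (inj₂ (inj₂ (inj₂ (j≡0 , i≡m)))) = inj₁ (trans (toℕ-injective j≡0) (sym (next-last i i≡m)))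

  next⇒CycConsec : ∀ i j → j ≡ next i ⊎ i ≡ next j → CycConsec m (toℕ i) (toℕ j)
  next⇒CycConsec i _ (inj₁ refl) = next-CycConsec i
  next⇒CycConsec _ j (inj₂ refl) = CycConsec-sym _ _ (next-CycConsec j)

  rotate : ℕ → Fin (suc m) → Fin (suc m)
  rotate zero    i = i
  rotate (suc t) i = next (rotate t i)

  rotate-next : ∀ t i → rotate t (next i) ≡ next (rotate t i)
  rotate-next zero    i = refl
  rotate-next (suc t) i = cong next (rotate-next t i)

  rotate-injective : ∀ t i j → rotate t i ≡ rotate t j → i ≡ j
  rotate-injective zero    i j e = e
  rotate-injective (suc t) i j e = rotate-injective t i j (next-injective _ _ e)

  toℕ-rotate-zero : ∀ t → t ≤ m → toℕ (rotate t Fin.zero) ≡ t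
  toℕ-rotate-zero zero    _   = refl
  toℕ-rotate-zero (suc t) t<m = trans (toℕ-next _ rotated≢m) (cong suc ih)
    where
    ih : toℕ (rotate t Fin.zero) ≡ t
    ih = toℕ-rotate-zero t (<⇒≤ t<m)
    rotated≢m : toℕ (rotate t Fin.zero) ≢ m
    rotated≢m e = <-irrefl (trans (sym ih) e) t<m

  rotate-zero : ∀ i → rotate (toℕ i) Fin.zero ≡ i
  rotate-zero i = toℕ-injective (toℕ-rotate-zero (toℕ i) (toℕ≤m i))

  position : ℕ → Fin (suc m)
  position k with k ℕ.≤? m
  ... | yes k≤m = fromℕ< (s≤s k≤m)
  ... | no _    = Fin.zero

  toℕ-position : ∀ k → k ≤ m → toℕ (position k) ≡ k
  toℕ-position k k≤m with k ℕ.≤? m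
  ... | yes k≤m′ = toℕ-fromℕ< (s≤s k≤m′)
  ... | no k≰m   = ⊥-elim (k≰m k≤m)

  position-toℕ : ∀ i → position (toℕ i) ≡ i
  position-toℕ i = toℕ-injective (toℕ-position (toℕ i) (toℕ≤m i))

  position-zero : position 0 ≡ Fin.zero
  position-zero = toℕ-injective (toℕ-position 0 z≤n)

  -- Reading positions past m yields the junk value zero; at m + 1 this is exactly what closes the cycle.
  position-overflow : position (suc m) ≡ Fin.zero
  position-overflow with suc m ℕ.≤? m
  ... | yes m+1≤m = ⊥-elim (1+n≰n m+1≤m)
  ... | no _      = refl

  position-step : ∀ k → k ≤ m → CycConsec m (toℕ (position k)) (toℕ (position (suc k)))
  position-step k k≤m with k ℕ.≟ m
  ... | yes refl = subst (CycConsec m (toℕ (position m)) ∘ toℕ) (sym position-overflow)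
                     (inj₂ (inj₂ (inj₂ (refl , toℕ-position m ≤-refl))))
  ... | no k≢m   = inj₁ (trans (cong suc (toℕ-position k k≤m)) (sym (toℕ-position (suc k) (≤∧≢⇒< k≤m k≢m))))

  positions-nonconsecutive : ∀ s t → 1 ≤ s → suc s < t → t ≤ m →
    toℕ (position s) ≢ toℕ (position t) × ¬ CycConsec m (toℕ (position s)) (toℕ (position t))
  positions-nonconsecutive s t 1≤s s+1<t t≤m
    rewrite toℕ-position s (≤-trans (<⇒≤ (<-trans (n<1+n s) s+1<t)) t≤m) | toℕ-position t t≤m =
    (λ s≡t → <-irrefl s≡t s<t) , nonconsecutive
    where
    s<t : s < t
    s<t = <-trans (n<1+n s) s+1<t
    nonconsecutive : ¬ CycConsec m s t
    nonconsecutive (inj₁ e)                      = <-irrefl e s+1<t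
    nonconsecutive (inj₂ (inj₁ e))               = <-asym s<t (subst (t <_) e (n<1+n t))
    nonconsecutive (inj₂ (inj₂ (inj₁ (s≡0 , _)))) = 1+n≰n (subst (1 ≤_) s≡0 1≤s)
    nonconsecutive (inj₂ (inj₂ (inj₂ (_ , s≡m)))) = <-irrefl s≡m (<-≤-trans s<t t≤m)

open CyclicOrder

module _ {V : Set} (H : Graph V) where

  IsCycle-rotate : ∀ {m} (c : Fin (suc m) → V) t → IsCycle H m c → IsCycle H m (c ∘ rotate t)
  IsCycle-rotate c t (c-injective , c-edges) =
    (λ e → rotate-injective t _ _ (c-injective e)) ,
    λ i j ij → c-edges (rotate t i) (rotate t j) (next⇒CycConsec _ _ (rotated (CycConsec⇒next i j ij)))
    where
    rotated : ∀ {i j} → j ≡ next i ⊎ i ≡ next j → rotate t j ≡ next (rotate t i) ⊎ rotate t i ≡ next (rotate t j)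
    rotated (inj₁ refl) = inj₁ (rotate-next t _)
    rotated (inj₂ refl) = inj₂ (rotate-next t _)

  HasChord-rotate : ∀ {m} (c : Fin (suc m) → V) t → HasChord H m (c ∘ rotate t) → HasChord H m c
  HasChord-rotate c t (i , j , i≢j , ¬ij , edge) =
    rotate t i , rotate t j ,
    (λ e → i≢j (cong toℕ (rotate-injective t _ _ (toℕ-injective e)))) ,
    (λ ij → ¬ij (next⇒CycConsec i j (unrotated (CycConsec⇒next _ _ ij)))) ,
    edge
    where
    unrotated : rotate t j ≡ next (rotate t i) ⊎ rotate t i ≡ next (rotate t j) → j ≡ next i ⊎ i ≡ next j
    unrotated (inj₁ e) = inj₁ (rotate-injective t _ _ (trans e (sym (rotate-next t i))))
    unrotated (inj₂ e) = inj₂ (rotate-injective t _ _ (trans e (sym (rotate-next t j))))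

  chordal-by-rotation : (Q : V → Set) → (∀ v → Dec (Q v)) →
    (∀ m c → 3 ≤ m → IsCycle H m c → Q (c Fin.zero) → HasChord H m c) →
    (∀ m c → 3 ≤ m → IsCycle H m c → (∀ i → ¬ Q (c i)) → HasChord H m c) →
    Chordal H
  chordal-by-rotation Q Q? rooted avoiding m c 3≤m cycle with any? (λ i → Q? (c i))
  ... | yes (i , Qci) = HasChord-rotate c (toℕ i)
          (rooted m (c ∘ rotate (toℕ i)) 3≤m (IsCycle-rotate c (toℕ i) cycle) (subst Q (cong c (sym (rotate-zero i))) Qci))
  ... | no ¬∃Q = avoiding m c 3≤m cycle (λ i Qci → ¬∃Q (i , Qci))

module EdgeDeletion {V : Set} (H : Graph V) (R : V → V → Bool) (R-sym : ∀ u w → R u w ≡ R w u) where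

  H∖R : Graph V
  H∖R = record
    { adj    = λ u w → adj H u w ∧ not (R u w)
    ; sym    = λ u w → cong₂ _∧_ (Graph.sym H u w) (cong not (R-sym u w))
    ; irrefl = λ v → cong (_∧ not (R v v)) (Graph.irrefl H v)
    }

  H∖R⊆H : H∖R ⊆ᴱ H
  H∖R⊆H u w = T-∧-elimˡ

  kept : ∀ {u w} → T (adj H u w) → ¬ T (R u w) → T (adj H∖R u w)
  kept e ¬r = T-∧-intro e (T-not-intro ¬r)

  removed : ∀ {u w} → T (adj H∖R u w) → ¬ T (R u w)
  removed {u} {w} e = T-not-elim (T-∧-elimʳ {adj H u w} e)

  IsCycle-H∖R : ∀ {m c} → IsCycle H∖R m c → IsCycle H m c
  IsCycle-H∖R {c = c} (c-injective , c-edges) = c-injective , λ i j ij → H∖R⊆H (c i) (c j) (c-edges i j ij)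

  minimal-triangulation-keeps-edges : ∀ {M} → IsMinimalTriangulation M H →
    Chordal H∖R → M ⊆ᴱ H∖R → ∀ u w → T (adj H u w) → ¬ T (R u w)
  minimal-triangulation-keeps-edges (_ , minimal) chordal M⊆H∖R u w e r =
    minimal H∖R (chordal , M⊆H∖R) (H∖R⊆H , u , w , e , λ e′ → removed e′ r)

crossing : (P : ℕ → Set) → (∀ k → Dec (P k)) → ∀ a b → a ≤ b → P a → ¬ P b →
  ∃[ k ] (a ≤ k × k < b × P k × ¬ P (suc k))
crossing P P? a zero    a≤0   Pa ¬P0 = ⊥-elim (¬P0 (subst P (n≤0⇒n≡0 a≤0) Pa))
crossing P P? a (suc b) a≤b+1 Pa ¬Pb+1 with m≤n⇒m<n∨m≡n a≤b+1 | P? b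
... | inj₂ refl | _   = ⊥-elim (¬Pb+1 Pa)
... | inj₁ a≤b  | yes Pb = b , ≤-pred a≤b , n<1+n b , Pb , ¬Pb+1
... | inj₁ a≤b  | no ¬Pb =
      let k , a≤k , k<b , Pk , ¬Pk+1 = crossing P P? a b (≤-pred a≤b) Pa ¬Pb
      in k , a≤k , m<n⇒m<1+n k<b , Pk , ¬Pk+1

∃-between? : (P : ℕ → Set) → (∀ k → Dec (P k)) → ∀ a b →
  (∃[ k ] (a ≤ k × k < b × P k)) ⊎ (∀ k → a ≤ k → k < b → ¬ P k)
∃-between? P P? a zero    = inj₂ λ _ _ ()
∃-between? P P? a (suc b) with ∃-between? P P? a b | a ℕ.≤? b | P? b
... | inj₁ (k , a≤k , k<b , Pk) | _        | _      = inj₁ (k , a≤k , m<n⇒m<1+n k<b , Pk)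
... | inj₂ none                 | yes a≤b  | yes Pb = inj₁ (b , a≤b , n<1+n b , Pb)
... | inj₂ none                 | yes a≤b  | no ¬Pb = inj₂ λ k a≤k k<b+1 → [ none k a≤k , (λ { refl → ¬Pb }) ] (m<1+n⇒m<n∨m≡n k<b+1)
... | inj₂ none                 | no a≰b   | _      = inj₂ λ k a≤k k<b+1 _ → a≰b (≤-trans a≤k (≤-pred k<b+1))

module InducedPaths {V : Set} (_≟_ : DecidableEquality V) (H : Graph V) where

  Adj : V → V → Set
  Adj u w = T (adj H u w)

  Adj-sym : ∀ {u w} → Adj u w → Adj w u
  Adj-sym {u} {w} = subst T (Graph.sym H u w)

  Adj-irrefl : ∀ {u w} → Adj u w → u ≢ w
  Adj-irrefl {u} e refl = subst T (Graph.irrefl H u) e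

  Linked : List V → Set
  Linked []           = ⊤
  Linked (v ∷ [])     = ⊤
  Linked (v ∷ w ∷ us) = Adj v w × Linked (w ∷ us)

  data InducedPath : List V → Set where
    single : ∀ v → InducedPath (v ∷ [])
    extend : ∀ {v w us} → Adj v w → All (v ≢_) (w ∷ us) → All (¬_ ∘ Adj v) us →
             InducedPath (w ∷ us) → InducedPath (v ∷ w ∷ us)

  end : V → List V → V
  end v []       = v
  end v (w ∷ ws) = end w ws

  end-∈ : ∀ v ws → end v ws ∈ˡ (v ∷ ws)
  end-∈ v []       = here refl
  end-∈ v (w ∷ ws) = there (end-∈ w ws)

  AllButLast : (V → Set) → List V → Set
  AllButLast Q []           = ⊤
  AllButLast Q (v ∷ [])     = ⊤
  AllButLast Q (v ∷ w ∷ us) = Q v × AllButLast Q (w ∷ us)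

  data Suffix : List V → List V → Set where
    self : ∀ {l} → Suffix l l
    drop : ∀ {s u l} → Suffix s l → Suffix s (u ∷ l)

  ⊆-self : ∀ (l : List V) → All (_∈ˡ l) l
  ⊆-self []       = []
  ⊆-self (x ∷ xs) = here refl ∷ All.map there (⊆-self xs)

  Suffix-⊆ : ∀ {s l} → Suffix s l → All (_∈ˡ l) s
  Suffix-⊆ {s} self  = ⊆-self s
  Suffix-⊆ (drop sf) = All.map there (Suffix-⊆ sf)

  Suffix-InducedPath : ∀ {u ss l} → Suffix (u ∷ ss) l → InducedPath l → InducedPath (u ∷ ss)
  Suffix-InducedPath self      p                  = p
  Suffix-InducedPath (drop ()) (single _)
  Suffix-InducedPath (drop sf) (extend _ _ _ p) = Suffix-InducedPath sf p

  Suffix-end : ∀ {u ss v us} → Suffix (u ∷ ss) (v ∷ us) → end u ss ≡ end v us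
  Suffix-end self                     = refl
  Suffix-end {us = []}     (drop ())
  Suffix-end {us = w ∷ us} (drop sf) = Suffix-end sf

  Suffix-AllButLast : ∀ {Q s l} → Suffix s l → AllButLast Q l → AllButLast Q s
  Suffix-AllButLast self                       q       = q
  Suffix-AllButLast (drop {l = []} self)       _       = tt
  Suffix-AllButLast (drop {l = w ∷ us} sf)     (_ , q) = Suffix-AllButLast sf q

  last-satisfying : (P : V → Set) → (∀ v → Dec (P v)) → ∀ l → Any P l →
    ∃[ u ] ∃[ ss ] (Suffix (u ∷ ss) l × P u × All (¬_ ∘ P) ss)
  last-satisfying P P? (u ∷ us) Pl with Any.any? P? us
  ... | yes Pus = let (u′ , ss , sf , Pu′ , rest) = last-satisfying P P? us Pus in u′ , ss , drop sf , Pu′ , rest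
  ... | no ¬Pus = u , us , self , head Pl , ¬Any⇒All¬ us ¬Pus
    where
    head : Any P (u ∷ us) → P u
    head (here Pu)    = Pu
    head (there Pus) = ⊥-elim (¬Pus Pus)

  private
    ∈-tail-step : ∀ {w z : V} {us rs} → All (_∈ˡ (w ∷ us)) rs → z ∈ˡ (w ∷ rs) → z ∈ˡ (w ∷ us)
    ∈-tail-step _   (here e) = here e
    ∈-tail-step rs⊆ (there z∈rs) = All.lookup rs⊆ z∈rs

    EqOrAdj : V → V → Set
    EqOrAdj v z = v ≡ z ⊎ Adj v z

    EqOrAdj? : ∀ v z → Dec (EqOrAdj v z)
    EqOrAdj? v z with v ≟ z | T? (adj H v z)
    ... | yes v≡z | _       = yes (inj₁ v≡z)
    ... | no _    | yes vz  = yes (inj₂ vz)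
    ... | no v≢z  | no ¬vz = no λ { (inj₁ v≡z) → v≢z v≡z ; (inj₂ vz) → ¬vz vz }

  -- Shortcut: from the induced path on the tail, jump from v to the last vertex equal or adjacent to it.
  induced-subpath : ∀ v us → Linked (v ∷ us) →
    ∃[ rs ] (InducedPath (v ∷ rs) × All (_∈ˡ (v ∷ us)) rs × end v rs ≡ end v us)
  induced-subpath v []       _             = [] , single v , [] , refl
  induced-subpath v (w ∷ us) (v-w , linked) with induced-subpath w us linked
  ... | rs , path , rs⊆ , same-end with last-satisfying (EqOrAdj v) (EqOrAdj? v) (w ∷ rs) (here (inj₂ v-w))
  ...   | u , ss , sf , inj₁ refl , later =
          ss , Suffix-InducedPath sf path ,
          All.map (there ∘ ∈-tail-step rs⊆) (All.tail (Suffix-⊆ sf)) ,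
          trans (Suffix-end sf) same-end
  ...   | u , ss , sf , inj₂ v-u , later =
          u ∷ ss ,
          extend v-u (Adj-irrefl v-u ∷ All.map (λ ¬p e → ¬p (inj₁ e)) later) (All.map (λ ¬p e → ¬p (inj₂ e)) later)
                 (Suffix-InducedPath sf path) ,
          All.map (there ∘ ∈-tail-step rs⊆) (Suffix-⊆ sf) ,
          trans (Suffix-end sf) same-end

  cut-at-neighbour : ∀ x v rs → InducedPath (v ∷ rs) → Adj x (end v rs) →
    ∃[ rs′ ] (InducedPath (v ∷ rs′) × All (_∈ˡ rs) rs′ × Adj x (end v rs′) × AllButLast (¬_ ∘ Adj x) (v ∷ rs′))
  cut-at-neighbour x v []       path x-end = [] , path , [] , x-end , tt
  cut-at-neighbour x v (w ∷ rs) (extend v-w v∉ v-far path) x-end with T? (adj H x v)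
  ... | yes x-v = [] , single v , [] , x-v , tt
  ... | no ¬x-v with cut-at-neighbour x w rs path x-end
  ...   | rs′ , path′ , rs′⊆ , x-end′ , x-far =
          w ∷ rs′ ,
          extend v-w (All.head v∉ ∷ All.map (All.lookup (All.tail v∉)) rs′⊆) (All.map (All.lookup v-far) rs′⊆) path′ ,
          here refl ∷ All.map there rs′⊆ ,
          x-end′ ,
          ¬x-v , x-far

  InducedPath-adjacent : ∀ {l} → InducedPath l → ∀ i j → suc (toℕ i) ≡ toℕ j → Adj (lookup l i) (lookup l j)
  InducedPath-adjacent (extend v-w _ _ _) Fin.zero    (Fin.suc Fin.zero) _ = v-w
  InducedPath-adjacent (extend _ _ _ p)   (Fin.suc i) (Fin.suc j)        e = InducedPath-adjacent p i j (suc-injective e)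
  InducedPath-adjacent (single _)            Fin.zero    Fin.zero           ()
  InducedPath-adjacent (extend _ _ _ _)   Fin.zero    Fin.zero           ()
  InducedPath-adjacent (extend _ _ _ _)   Fin.zero    (Fin.suc (Fin.suc _)) ()

  InducedPath-nonadjacent : ∀ {l} → InducedPath l → ∀ i j → suc (toℕ i) < toℕ j → ¬ Adj (lookup l i) (lookup l j)
  InducedPath-nonadjacent (extend _ _ v-far _) Fin.zero    (Fin.suc (Fin.suc j)) _         = All.lookup v-far (∈-lookup j)
  InducedPath-nonadjacent (extend _ _ _ p)     (Fin.suc i) (Fin.suc j)           (s≤s i+1<j) = InducedPath-nonadjacent p i j i+1<j
  InducedPath-nonadjacent (extend _ _ _ _)     Fin.zero    (Fin.suc Fin.zero)    (s≤s ())
  InducedPath-nonadjacent (single _)            Fin.zero    Fin.zero              ()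

  InducedPath-injective : ∀ {l} → InducedPath l → ∀ i j → lookup l i ≡ lookup l j → i ≡ j
  InducedPath-injective (single _)           Fin.zero    Fin.zero    _ = refl
  InducedPath-injective (extend _ _ _ _)   Fin.zero    Fin.zero    _ = refl
  InducedPath-injective (extend _ v∉ _ _)  Fin.zero    (Fin.suc j) e = ⊥-elim (All.lookup v∉ (∈-lookup j) e)
  InducedPath-injective (extend _ v∉ _ _)  (Fin.suc i) Fin.zero    e = ⊥-elim (All.lookup v∉ (∈-lookup i) (sym e))
  InducedPath-injective (extend _ _ _ p)   (Fin.suc i) (Fin.suc j) e = cong Fin.suc (InducedPath-injective p i j e)

  lookup-end : ∀ u rest (i : Fin (length (u ∷ rest))) → suc (toℕ i) ≡ length (u ∷ rest) → lookup (u ∷ rest) i ≡ end u rest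
  lookup-end u []      Fin.zero    _ = refl
  lookup-end u (w ∷ r) (Fin.suc i) e = lookup-end w r i (suc-injective e)

  lookup-AllButLast : ∀ {Q} u rest → AllButLast Q (u ∷ rest) →
    (i : Fin (length (u ∷ rest))) → suc (toℕ i) < length (u ∷ rest) → Q (lookup (u ∷ rest) i)
  lookup-AllButLast u []      _        Fin.zero    (s≤s ())
  lookup-AllButLast u (w ∷ r) (q , _)  Fin.zero    _          = q
  lookup-AllButLast u (w ∷ r) (_ , qs) (Fin.suc i) (s≤s i+1<) = lookup-AllButLast w r qs i i+1<

  -- Read cyclically, x ∷ y ∷ u ∷ s ∷ ss is a cycle of length at least four without chords.
  module ClosedByVertex {x y u s : V} {ss : List V}
    (path : InducedPath (y ∷ u ∷ s ∷ ss)) (x-y : Adj x y) (x-end : Adj x (end s ss))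
    (x-interior : AllButLast (¬_ ∘ Adj x) (u ∷ s ∷ ss)) (x∉path : All (x ≢_) (y ∷ u ∷ s ∷ ss)) where

    private
      m : ℕ
      m = suc (suc (suc (length ss)))

      cycle : Fin (suc m) → V
      cycle = lookup (x ∷ y ∷ u ∷ s ∷ ss)

      injective : ∀ a b → cycle a ≡ cycle b → a ≡ b
      injective Fin.zero    Fin.zero    _ = refl
      injective Fin.zero    (Fin.suc b) e = ⊥-elim (All.lookup x∉path (∈-lookup b) e)
      injective (Fin.suc a) Fin.zero    e = ⊥-elim (All.lookup x∉path (∈-lookup a) (sym e))
      injective (Fin.suc a) (Fin.suc b) e = cong Fin.suc (InducedPath-injective path a b e)

      edge-succ : ∀ a b → suc (toℕ a) ≡ toℕ b → Adj (cycle a) (cycle b)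
      edge-succ Fin.zero    (Fin.suc Fin.zero)       _  = x-y
      edge-succ (Fin.suc a) (Fin.suc b)              e  = InducedPath-adjacent path a b (suc-injective e)
      edge-succ Fin.zero    Fin.zero                 ()
      edge-succ Fin.zero    (Fin.suc (Fin.suc _))    ()
      edge-succ (Fin.suc _) Fin.zero                 ()

      edge-wrap : ∀ a b → toℕ a ≡ 0 → toℕ b ≡ m → Adj (cycle a) (cycle b)
      edge-wrap Fin.zero (Fin.suc b) _ e = subst (Adj x) (sym (lookup-end y (u ∷ s ∷ ss) b e)) x-end

      edges : ∀ a b → CycConsec m (toℕ a) (toℕ b) → Adj (cycle a) (cycle b)
      edges a b (inj₁ e)                     = edge-succ a b e
      edges a b (inj₂ (inj₁ e))              = Adj-sym (edge-succ b a e)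
      edges a b (inj₂ (inj₂ (inj₁ (a0 , bm)))) = edge-wrap a b a0 bm
      edges a b (inj₂ (inj₂ (inj₂ (b0 , am)))) = Adj-sym (edge-wrap b a b0 am)

      no-chord : ∀ a b → toℕ a < toℕ b → ¬ CycConsec m (toℕ a) (toℕ b) → ¬ Adj (cycle a) (cycle b)
      no-chord Fin.zero    (Fin.suc Fin.zero)    _         ¬cons = ⊥-elim (¬cons (inj₁ refl))
      no-chord Fin.zero    (Fin.suc (Fin.suc b)) _         ¬cons with suc (toℕ b) ℕ.<? length (u ∷ s ∷ ss)
      ... | yes interior = lookup-AllButLast u (s ∷ ss) x-interior b interior
      ... | no ¬interior = ⊥-elim (¬cons (inj₂ (inj₂ (inj₁ (refl , cong suc (≤-antisym (toℕ<n b) (≮⇒≥ ¬interior)))))))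
      no-chord (Fin.suc a) (Fin.suc b)           (s≤s a<b) ¬cons with suc (toℕ a) ℕ.≟ toℕ b
      ... | yes a+1≡b = ⊥-elim (¬cons (inj₁ (cong suc a+1≡b)))
      ... | no a+1≢b  = InducedPath-nonadjacent path a b (≤∧≢⇒< a<b a+1≢b)

    not-chordal : ¬ Chordal H
    not-chordal chordal with chordal m cycle (s≤s (s≤s (s≤s z≤n))) ((λ {a} {b} → injective a b) , edges)
    ... | a , b , a≢b , ¬cons , a-b with <-cmp (toℕ a) (toℕ b)
    ...   | tri< a<b _ _ = no-chord a b a<b ¬cons a-b
    ...   | tri≈ _ a≡b _ = a≢b a≡b
    ...   | tri> _ _ b<a = no-chord b a b<a (¬cons ∘ CycConsec-sym _ _) (Adj-sym a-b)

-- Potential maximal cliques of a minimal triangulation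

module MinimalTriangulation {V : Set} (_≟_ : DecidableEquality V) (vertices : List V) (∈-vertices : ∀ v → v ∈ˡ vertices)
  (M H : Graph V) (Ω : VSet V) (minimal : IsMinimalTriangulation M H) (maximal-clique : IsMaximalClique H Ω) where

  open InducedPaths _≟_ H public

  chordal : Chordal H
  chordal = proj₁ (proj₁ minimal)

  M⊆H : M ⊆ᴱ H
  M⊆H = proj₂ (proj₁ minimal)

  Ω-clique : IsClique H Ω
  Ω-clique = proj₁ maximal-clique

  ∃? : {P : V → Set} → (∀ v → Dec (P v)) → Dec (∃ P)
  ∃? P? with Any.any? P? vertices
  ... | yes some = yes (Any.satisfied some)
  ... | no none  = no λ (v , Pv) → none (lose (∈-vertices v) Pv)

  Neighbour : VSet V → V → Set
  Neighbour C v = ∃[ c ] (T (C c) × T (adj M c v))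

  walk-vertices : ∀ {u v} → Walk M Ω u v → List V
  walk-vertices (here _)            = []
  walk-vertices (step {w = w} _ _ p) = w ∷ walk-vertices p

  walk-Linked : ∀ {u v} (p : Walk M Ω u v) → Linked (u ∷ walk-vertices p)
  walk-Linked (here _)               = tt
  walk-Linked (step {u} {w} _ e p) = M⊆H u w e , walk-Linked p

  walk-end : ∀ {u v} (p : Walk M Ω u v) → end u (walk-vertices p) ≡ v
  walk-end (here _)     = refl
  walk-end (step _ _ p) = walk-end p

  walk-start-∉Ω : ∀ {u v} → Walk M Ω u v → ¬ T (Ω u)
  walk-start-∉Ω (here u∉Ω)     = T-not-elim u∉Ω
  walk-start-∉Ω (step u∉Ω _ _) = T-not-elim u∉Ω

  adjacent-to-Ω⇒∈Ω : ∀ c → (∀ v → T (Ω v) → Adj c v) → T (Ω c)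
  adjacent-to-Ω⇒∈Ω c c-Ω = proj₂ maximal-clique Ω+c clique (λ _ → T-∨-introˡ) c (T-∨-introʳ {Ω c} (fromWitness refl))
    where
    Ω+c : VSet V
    Ω+c w = Ω w ∨ isYes (w ≟ c)
    clique : IsClique H Ω+c
    clique u w u∈ w∈ u≢w with T-∨-elim {Ω u} u∈ | T-∨-elim {Ω w} w∈
    ... | inj₁ u∈Ω | inj₁ w∈Ω = Ω-clique u w u∈Ω w∈Ω u≢w
    ... | inj₁ u∈Ω | inj₂ w≡c = subst (Adj u) (sym (toWitness w≡c)) (Adj-sym (c-Ω u u∈Ω))
    ... | inj₂ u≡c | inj₁ w∈Ω = subst (λ z → Adj z w) (sym (toWitness u≡c)) (c-Ω w w∈Ω)
    ... | inj₂ u≡c | inj₂ w≡c = ⊥-elim (u≢w (trans (toWitness u≡c) (sym (toWitness w≡c))))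

  module Component (C : VSet V) (C-component : IsComponent M Ω C) where

    nonempty : ∃[ v ] T (C v)
    nonempty = proj₁ C-component

    connected : ∀ {u v} → T (C u) → T (C v) → Walk M Ω u v
    connected {u} {v} = proj₁ (proj₂ (proj₂ C-component)) u v

    outside-Ω : ∀ {v} → T (C v) → ¬ T (Ω v)
    outside-Ω {v} v∈C = T-not-elim (proj₁ (proj₂ C-component) v v∈C)

    closed : ∀ {u v} → T (C u) → ¬ T (Ω v) → T (adj M u v) → T (C v)
    closed {u} {v} u∈C v∉Ω = proj₂ (proj₂ (proj₂ C-component)) u v u∈C (T-not-intro v∉Ω)

    Neighbour? : ∀ v → Dec (Neighbour C v)
    Neighbour? v = ∃? (λ c → T? (C c) ×-dec T? (adj M c v))

    neighbour⇒Ω : ∀ {v} → Neighbour C v → ¬ T (C v) → T (Ω v)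
    neighbour⇒Ω {v} (c , c∈C , c-v) v∉C = T-stable λ v∉Ω → v∉C (closed c∈C v∉Ω c-v)

    far : V → Bool
    far w = not (C w) ∧ not (isYes (Neighbour? w))

    far-intro : ∀ {w} → ¬ T (C w) → ¬ Neighbour C w → T (far w)
    far-intro w∉C ¬Nw = T-∧-intro (T-not-intro w∉C) (T-not-intro (¬Nw ∘ toWitness))

    cut : V → V → Bool
    cut u w = (C u ∧ far w) ∨ (C w ∧ far u)

    open EdgeDeletion H cut (λ u w → ∨-comm (C u ∧ far w) (C w ∧ far u))

    leaving-edge : ∀ {u w} → T (adj H∖R u w) → T (C u) → ¬ T (C w) → Neighbour C w
    leaving-edge {u} {w} e u∈C w∉C = decidable-stable (Neighbour? w) λ ¬Nw →
      removed e (T-∨-introˡ (T-∧-intro u∈C (far-intro w∉C ¬Nw)))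

    cut-cases : ∀ u w → T (cut u w) → (T (C u) × T (far w)) ⊎ (T (C w) × T (far u))
    cut-cases u w r with T-∨-elim {C u ∧ far w} r
    ... | inj₁ p = inj₁ (T-∧-elimˡ p , T-∧-elimʳ {C u} p)
    ... | inj₂ p = inj₂ (T-∧-elimˡ p , T-∧-elimʳ {C w} p)

    far⇒∉C : ∀ {w} → T (far w) → ¬ T (C w)
    far⇒∉C fw = T-not-elim (T-∧-elimˡ fw)

    far⇒¬Neighbour : ∀ {w} → T (far w) → ¬ Neighbour C w
    far⇒¬Neighbour {w} fw Nw = T-not-elim (T-∧-elimʳ {not (C w)} fw) (fromWitness Nw)

    M⊆H∖R : M ⊆ᴱ H∖R
    M⊆H∖R u w e = kept (M⊆H u w e) not-cut
      where
      not-cut : ¬ T (cut u w)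
      not-cut r with cut-cases u w r
      ... | inj₁ (u∈C , far-w) = far⇒¬Neighbour far-w (u , u∈C , e)
      ... | inj₂ (w∈C , far-u) = far⇒¬Neighbour far-u (w , w∈C , subst T (Graph.sym M u w) e)

    Ω⇒¬cut : ∀ {u w} → T (Ω u) → T (Ω w) → ¬ T (cut u w)
    Ω⇒¬cut {u} {w} u∈Ω w∈Ω r with cut-cases u w r
    ... | inj₁ (u∈C , _) = outside-Ω u∈C u∈Ω
    ... | inj₂ (w∈C , _) = outside-Ω w∈C w∈Ω

    keep-chord : ∀ {m} {c : Fin (suc m) → V} (ch : HasChord H m c) →
      ¬ T (cut (c (proj₁ ch)) (c (proj₁ (proj₂ ch)))) → HasChord H∖R m c
    keep-chord (a , b , a≢b , ¬cons , e) ¬r = a , b , a≢b , ¬cons , kept e ¬r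

    -- A cycle through C that reaches a far vertex j leaves C and comes back through Ω on either side of j.
    module RootedAt {m} {c : Fin (suc m) → V} (cycle : IsCycle H∖R m c) (c₀∈C : T (C (c Fin.zero)))
                    (j : Fin (suc m)) (j-far : T (far (c j))) where

      J : ℕ
      J = toℕ j

      at : ℕ → V
      at k = c (position k)

      edge : ∀ k → k ≤ m → T (adj H∖R (at k) (at (suc k)))
      edge k k≤m = proj₂ cycle (position k) (position (suc k)) (position-step k k≤m)

      at-J∉C : ¬ T (C (at J))
      at-J∉C = subst (¬_ ∘ T ∘ C) (cong c (sym (position-toℕ j))) (far⇒∉C j-far)

      Neighbour⇒≢J : ∀ k → Neighbour C (at k) → k ≢ J
      Neighbour⇒≢J k Nk refl = far⇒¬Neighbour j-far (subst (Neighbour C ∘ c) (position-toℕ j) Nk)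

      exit : ∃[ s ] (1 ≤ s × s < J × T (Ω (at s)))
      exit =
        let k , _ , k<J , k∈C , k+1∉C = crossing (T ∘ C ∘ at) (T? ∘ C ∘ at) 0 J z≤n
                                          (subst (T ∘ C ∘ c) (sym position-zero) c₀∈C) at-J∉C
            N = leaving-edge (edge k (<⇒≤ (<-≤-trans k<J (toℕ≤m j)))) k∈C k+1∉C
        in suc k , s≤s z≤n , ≤∧≢⇒< k<J (Neighbour⇒≢J (suc k) N) , neighbour⇒Ω N k+1∉C

      entry : ∃[ t ] (J < t × t ≤ m × T (Ω (at t)))
      entry =
        let k , J≤k , k<m+1 , k∉C , ¬k+1∉C = crossing (¬_ ∘ T ∘ C ∘ at) (¬? ∘ T? ∘ C ∘ at) J (suc m) (<⇒≤ (s≤s (toℕ≤m j)))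
                                                at-J∉C (λ m+1∉C → m+1∉C (subst (T ∘ C ∘ c) (sym position-overflow) c₀∈C))
            N = leaving-edge (subst T (Graph.sym H∖R (at k) (at (suc k))) (edge k (≤-pred k<m+1))) (T-stable ¬k+1∉C) k∉C
        in k , ≤∧≢⇒< J≤k (Neighbour⇒≢J k N ∘ sym) , ≤-pred k<m+1 , neighbour⇒Ω N k∉C

      chord : HasChord H∖R m c
      chord = through-Ω exit entry
        where
        through-Ω : ∃[ s ] (1 ≤ s × s < J × T (Ω (at s))) → ∃[ t ] (J < t × t ≤ m × T (Ω (at t))) → HasChord H∖R m c
        through-Ω (s , 1≤s , s<J , s∈Ω) (t , J<t , t≤m , t∈Ω) =
          let s≢t , ¬cons = positions-nonconsecutive s t 1≤s (<-≤-trans (s≤s s<J) J<t) t≤m in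
          position s , position t , s≢t , ¬cons ,
          kept (Ω-clique _ _ s∈Ω t∈Ω (s≢t ∘ cong toℕ ∘ proj₁ cycle)) (Ω⇒¬cut s∈Ω t∈Ω)

    chordal-H∖R : Chordal H∖R
    chordal-H∖R = chordal-by-rotation H∖R (T ∘ C) (T? ∘ C) rooted avoiding
      where
      avoiding : ∀ m c → 3 ≤ m → IsCycle H∖R m c → (∀ i → ¬ T (C (c i))) → HasChord H∖R m c
      avoiding m c 3≤m cycle ∉C with chordal m c 3≤m (IsCycle-H∖R cycle)
      ... | ch@(a , b , _) = keep-chord ch λ r → [ ∉C a ∘ proj₁ , ∉C b ∘ proj₁ ] (cut-cases (c a) (c b) r)
      rooted : ∀ m c → 3 ≤ m → IsCycle H∖R m c → T (C (c Fin.zero)) → HasChord H∖R m c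
      rooted m c 3≤m cycle c₀∈C with any? (λ i → T? (far (c i)))
      ... | yes (j , j-far) = RootedAt.chord cycle c₀∈C j j-far
      ... | no none with chordal m c 3≤m (IsCycle-H∖R cycle)
      ...   | ch@(a , b , _) = keep-chord ch λ r → [ (λ p → none (b , proj₂ p)) , (λ p → none (a , proj₂ p)) ] (cut-cases (c a) (c b) r)

    walk-closed : ∀ {u v} → T (C u) → Walk M Ω u v → T (C v)
    walk-closed u∈C (here _)     = u∈C
    walk-closed u∈C (step _ e p) = walk-closed (closed u∈C (walk-start-∉Ω p) e) p

    absorbs : ∀ {C′} → IsComponent M Ω C′ → ∀ {z w} → T (C′ z) → T (C z) → T (C′ w) → T (C w)
    absorbs C′-component z∈C′ z∈C w∈C′ = walk-closed z∈C (proj₁ (proj₂ (proj₂ C′-component)) _ _ z∈C′ w∈C′)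

    -- Deleting the H-edges between C and the far vertices leaves a triangulation of M, so there are none.
    H-edge-from-C : ∀ {u v} → T (C u) → Adj u v → T (C v) ⊎ (T (Ω v) × Neighbour C v)
    H-edge-from-C {u} {v} u∈C u-v with T? (C v) | Neighbour? v
    ... | yes v∈C | _      = inj₁ v∈C
    ... | no v∉C  | yes Nv = inj₂ (neighbour⇒Ω Nv v∉C , Nv)
    ... | no v∉C  | no ¬Nv = ⊥-elim (minimal-triangulation-keeps-edges {M = M} minimal chordal-H∖R M⊆H∖R u v u-v
                                       (T-∨-introˡ (T-∧-intro u∈C (far-intro v∉C ¬Nv))))

    H-closed : ∀ {u v} → T (C u) → Adj u v → ¬ T (Ω v) → T (C v)
    H-closed u∈C u-v v∉Ω with H-edge-from-C u∈C u-v
    ... | inj₁ v∈C       = v∈C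
    ... | inj₂ (v∈Ω , _) = ⊥-elim (v∉Ω v∈Ω)

    H-neighbour : ∀ {u v} → T (C u) → Adj u v → T (Ω v) → Neighbour C v
    H-neighbour u∈C u-v v∈Ω with H-edge-from-C u∈C u-v
    ... | inj₁ v∈C      = ⊥-elim (outside-Ω v∈C v∈Ω)
    ... | inj₂ (_ , Nv) = Nv

    walk-in-C : ∀ {u v} → T (C u) → (p : Walk M Ω u v) → All (T ∘ C) (u ∷ walk-vertices p)
    walk-in-C u∈C (here _)     = u∈C ∷ []
    walk-in-C u∈C (step _ e p) = u∈C ∷ walk-in-C (closed u∈C (walk-start-∉Ω p) e) p

    path-to-neighbour : ∀ {c x} → T (C c) → Neighbour C x →
      ∃[ rs ] (InducedPath (c ∷ rs) × All (T ∘ C) (c ∷ rs) × Adj x (end c rs) × AllButLast (¬_ ∘ Adj x) (c ∷ rs))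
    path-to-neighbour {c} {x} c∈C (c₁ , c₁∈C , c₁-x) =
      let p = connected c∈C c₁∈C
          rs , path , rs⊆ , same-end = induced-subpath c (walk-vertices p) (walk-Linked p)
          x-end = subst (Adj x) (sym (trans same-end (walk-end p))) (Adj-sym (M⊆H c₁ x c₁-x))
          rs′ , path′ , rs′⊆rs , x-end′ , x-far = cut-at-neighbour x c rs path x-end
          rs⊆C = All.map (All.lookup (walk-in-C c∈C p)) rs⊆
      in rs′ , path′ , c∈C ∷ All.map (All.lookup rs⊆C) rs′⊆rs , x-end′ , x-far

    -- If the end of the path misses y, the last path vertex u adjacent to y closes, with x and y, a chordless cycle.
    path-end-adjacent : ∀ {c rs x y} → InducedPath (c ∷ rs) → All (T ∘ C) (c ∷ rs) →
      Adj x (end c rs) → AllButLast (¬_ ∘ Adj x) (c ∷ rs) → T (Ω x) → T (Ω y) → Adj c y → Adj (end c rs) y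
    path-end-adjacent {c} {rs} {x} {y} path path⊆C x-end x-far x∈Ω y∈Ω c-y with T? (adj H (end c rs) y) | x ≟ y
    ... | yes end-y | _     = end-y
    ... | no _      | yes refl = Adj-sym x-end
    ... | no ¬end-y | no x≢y with last-satisfying (Adj y) (T? ∘ adj H y) (c ∷ rs) (here (Adj-sym c-y))
    ...   | u , []     , sf , y-u , _ = ⊥-elim (¬end-y (Adj-sym (subst (Adj y) (Suffix-end sf) y-u)))
    ...   | u , s ∷ ss , sf , y-u , y-far =
            ⊥-elim (ClosedByVertex.not-chordal
                      (extend y-u (∉path y∈Ω) y-far (Suffix-InducedPath sf path))
                      (Ω-clique x y x∈Ω y∈Ω x≢y)
                      (subst (Adj x) (sym (Suffix-end sf)) x-end)
                      (Suffix-AllButLast sf x-far)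
                      (x≢y ∷ ∉path x∈Ω)
                      chordal)
      where
      ∉path : ∀ {z} → T (Ω z) → All (z ≢_) (u ∷ s ∷ ss)
      ∉path z∈Ω = All.map (λ w∈ z≡w → outside-Ω (All.lookup path⊆C w∈) (subst (T ∘ Ω) z≡w z∈Ω)) (Suffix-⊆ sf)

    extend-common-neighbour : ∀ {c K x} → T (C c) → All (Adj c) K → All (T ∘ Ω) K → T (Ω x) → Neighbour C x →
      ∃[ c′ ] (T (C c′) × Adj c′ x × All (Adj c′) K)
    extend-common-neighbour {c} c∈C c-K K⊆Ω x∈Ω Nx =
      let rs , path , path⊆C , x-end , x-far = path-to-neighbour c∈C Nx
      in end c rs , All.lookup path⊆C (end-∈ c rs) , Adj-sym x-end ,
         All.zipWith (λ (c-y , y∈Ω) → path-end-adjacent path path⊆C x-end x-far x∈Ω y∈Ω c-y) (c-K , K⊆Ω)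

    common-neighbour : (∀ v → T (Ω v) → Neighbour C v) → ∀ K → All (T ∘ Ω) K → ∃[ c ] (T (C c) × All (Adj c) K)
    common-neighbour full []      _              = proj₁ nonempty , proj₂ nonempty , []
    common-neighbour full (x ∷ K) (x∈Ω ∷ K⊆Ω) =
      let c , c∈C , c-K = common-neighbour full K K⊆Ω
          c′ , c′∈C , c′-x , c′-K = extend-common-neighbour c∈C c-K K⊆Ω x∈Ω (full x x∈Ω)
      in c′ , c′∈C , c′-x ∷ c′-K

    not-full : ¬ (∀ v → T (Ω v) → Neighbour C v)
    not-full full =
      let c , c∈C , c-Ω = common-neighbour full (filter (T? ∘ Ω) vertices) (all-filter (T? ∘ Ω) vertices)
      in outside-Ω c∈C (adjacent-to-Ω⇒∈Ω c λ v v∈Ω → All.lookup c-Ω (∈-filter⁺ (T? ∘ Ω) (∈-vertices v) v∈Ω))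

  SharedComponent : V → V → Set
  SharedComponent x y = ∃[ C ] (IsComponent M Ω C × Neighbour C x × Neighbour C y)

  SharedComponent-sym : ∀ {x y} → SharedComponent x y → SharedComponent y x
  SharedComponent-sym (C , C-component , Nx , Ny) = C , C-component , Ny , Nx

  module Separation (component-of : ∀ u → ¬ T (Ω u) → ∃[ C ] (IsComponent M Ω C × T (C u))) where

    arc-component : (f : ℕ → V) (s t : ℕ) → suc s < t → T (Ω (f s)) → T (Ω (f t)) →
      (∀ k → s ≤ k → k < t → Adj (f k) (f (suc k))) → (∀ k → s < k → k < t → ¬ T (Ω (f k))) →
      SharedComponent (f s) (f t)
    arc-component f s (suc t) s+1<t+1 s∈Ω t+1∈Ω edge interior = shared (component-of (f (suc s)) (interior (suc s) ≤-refl s+1<t+1))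
      where
      shared : ∃[ C ] (IsComponent M Ω C × T (C (f (suc s)))) → SharedComponent (f s) (f (suc t))
      shared (C , C-component , s+1∈C) =
        C , C-component ,
        H-neighbour s+1∈C (Adj-sym (edge s ≤-refl (≤-trans (n≤1+n (suc s)) s+1<t+1))) s∈Ω ,
        H-neighbour t∈C (edge t (≤-trans (n≤1+n s) s+1≤t) ≤-refl) t+1∈Ω
        where
        s+1≤t : suc s ≤ t
        s+1≤t = ≤-pred s+1<t+1
        open Component C C-component
        spread : ∀ d → d + suc s < suc t → T (C (f (d + suc s)))
        spread zero    _      = s+1∈C
        spread (suc d) inside =
          H-closed (spread d (<-trans (n<1+n _) inside))
                   (edge (d + suc s) (≤-trans (n≤1+n s) (m≤n+m (suc s) d)) (<-trans (n<1+n _) inside))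
                   (interior (suc (d + suc s)) (s≤s (≤-trans (n≤1+n s) (m≤n+m (suc s) d))) inside)
        t∈C : T (C (f t))
        t∈C = subst (T ∘ C ∘ f) (m∸n+n≡m s+1≤t) (spread (t ∸ suc s) (s≤s (≤-reflexive (m∸n+n≡m s+1≤t))))

    module NonEdge {x y : V} (x∈Ω : T (Ω x)) (y∈Ω : T (Ω y)) (x≢y : x ≢ y) (¬x-y : ¬ T (adj M x y))
                   (unshared : ¬ SharedComponent x y) where

      IsXY : V → V → Set
      IsXY u w = (u ≡ x × w ≡ y) ⊎ (u ≡ y × w ≡ x)

      is-xy : V → V → Bool
      is-xy u w = isYes ((u ≟ x ×-dec w ≟ y) ⊎-dec (u ≟ y ×-dec w ≟ x))

      is-xy-cases : ∀ u w → T (is-xy u w) → IsXY u w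
      is-xy-cases u w = toWitness

      is-xy-intro : ∀ {u w} → IsXY u w → T (is-xy u w)
      is-xy-intro = fromWitness

      is-xy-sym : ∀ u w → is-xy u w ≡ is-xy w u
      is-xy-sym u w = T-extensional (is-xy-intro ∘ flip ∘ is-xy-cases u w) (is-xy-intro ∘ flip ∘ is-xy-cases w u)
        where
        flip : ∀ {a b} → IsXY a b → IsXY b a
        flip (inj₁ (a≡x , b≡y)) = inj₂ (b≡y , a≡x)
        flip (inj₂ (a≡y , b≡x)) = inj₁ (b≡x , a≡y)

      open EdgeDeletion H is-xy is-xy-sym

      M⊆H∖R : M ⊆ᴱ H∖R
      M⊆H∖R u w e = kept (M⊆H u w e) λ r → [ (λ { (refl , refl) → ¬x-y e }) ,
                                                       (λ { (refl , refl) → ¬x-y (subst T (Graph.sym M u w) e) }) ] (is-xy-cases u w r)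

      -- A cycle through x and y, not consecutive, splits into two arcs; if both met Ω, those two Ω-vertices
      -- give a chord, and an arc avoiding Ω would be a component adjacent to both x and y.
      module Rooted {m} {c : Fin (suc m) → V} (cycle : IsCycle H∖R m c) (c₀≡x : c Fin.zero ≡ x)
                    (j : Fin (suc m)) (cj≡y : c j ≡ y) (2≤J : 2 ≤ toℕ j) (J<m : toℕ j < m) where

        J : ℕ
        J = toℕ j

        at : ℕ → V
        at k = c (position k)

        H-edge : ∀ k → k ≤ m → Adj (at k) (at (suc k))
        H-edge k k≤m = H∖R⊆H _ _ (proj₂ cycle (position k) (position (suc k)) (position-step k k≤m))

        at-0 : at 0 ≡ x
        at-0 = trans (cong c position-zero) c₀≡x

        at-J : at J ≡ y
        at-J = trans (cong c (position-toℕ j)) cj≡y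

        at-m+1 : at (suc m) ≡ x
        at-m+1 = trans (cong c position-overflow) c₀≡x

        at≡x⇒0 : ∀ k → k ≤ m → at k ≡ x → k ≡ 0
        at≡x⇒0 k k≤m e = trans (sym (toℕ-position k k≤m)) (cong toℕ (proj₁ cycle (trans e (sym c₀≡x))))

        at≡y⇒J : ∀ k → k ≤ m → at k ≡ y → k ≡ J
        at≡y⇒J k k≤m e = trans (sym (toℕ-position k k≤m)) (cong toℕ (proj₁ cycle (trans e (sym cj≡y))))

        first-arc : ∃[ k ] (1 ≤ k × k < J × T (Ω (at k)))
        first-arc with ∃-between? (T ∘ Ω ∘ at) (T? ∘ Ω ∘ at) 1 J
        ... | inj₁ found = found
        ... | inj₂ none  = ⊥-elim (unshared (subst₂ SharedComponent at-0 at-J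
                 (arc-component at 0 J 2≤J (subst (T ∘ Ω) (sym at-0) x∈Ω) (subst (T ∘ Ω) (sym at-J) y∈Ω)
                                (λ k _ k<J → H-edge k (<⇒≤ (<-trans k<J J<m))) none)))

        second-arc : ∃[ k ] (suc J ≤ k × k < suc m × T (Ω (at k)))
        second-arc with ∃-between? (T ∘ Ω ∘ at) (T? ∘ Ω ∘ at) (suc J) (suc m)
        ... | inj₁ found = found
        ... | inj₂ none  = ⊥-elim (unshared (SharedComponent-sym (subst₂ SharedComponent at-J at-m+1
                 (arc-component at J (suc m) (s≤s J<m) (subst (T ∘ Ω) (sym at-J) y∈Ω) (subst (T ∘ Ω) (sym at-m+1) x∈Ω)
                                (λ k _ k<m+1 → H-edge k (≤-pred k<m+1)) none))))

        chord : HasChord H∖R m c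
        chord =
          let k₁ , 1≤k₁ , k₁<J , k₁∈Ω = first-arc
              k₂ , J<k₂ , k₂<m+1 , k₂∈Ω = second-arc
              k₁≤m = <⇒≤ (<-trans k₁<J J<m)
              k₁≢k₂ , ¬cons = positions-nonconsecutive k₁ k₂ 1≤k₁ (<-≤-trans (s≤s k₁<J) J<k₂) (≤-pred k₂<m+1)
              ¬xy : ¬ T (is-xy (at k₁) (at k₂))
              ¬xy r = [ (λ p → 1+n≰n (subst (1 ≤_) (at≡x⇒0 k₁ k₁≤m (proj₁ p)) 1≤k₁)) ,
                                 (λ p → <-irrefl (at≡y⇒J k₁ k₁≤m (proj₁ p)) k₁<J) ] (is-xy-cases _ _ r)
          in position k₁ , position k₂ , k₁≢k₂ , ¬cons ,
             kept (Ω-clique _ _ k₁∈Ω k₂∈Ω (k₁≢k₂ ∘ cong toℕ ∘ proj₁ cycle)) ¬xy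

      chordal-H∖R : Chordal H∖R
      chordal-H∖R = chordal-by-rotation H∖R (_≡ x) (_≟ x) rooted avoiding
        where
        avoiding : ∀ m c → 3 ≤ m → IsCycle H∖R m c → (∀ i → c i ≢ x) → HasChord H∖R m c
        avoiding m c 3≤m cycle ∌x with chordal m c 3≤m (IsCycle-H∖R cycle)
        ... | a , b , a≢b , ¬cons , e =
              a , b , a≢b , ¬cons , kept e λ r → [ ∌x a ∘ proj₁ , ∌x b ∘ proj₂ ] (is-xy-cases _ _ r)

        through : ∀ {m c} → IsCycle H∖R m c → c Fin.zero ≡ x →
          ∀ j → c j ≡ y → toℕ j ≢ 0 → ¬ CycConsec m 0 (toℕ j) → HasChord H∖R m c
        through cycle c₀≡x j cj≡y J≢0 ¬cons =
          Rooted.chord cycle c₀≡x j cj≡y (2≤ (toℕ j) J≢0 (¬cons ∘ inj₁ ∘ sym))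
                       (≤∧≢⇒< (toℕ≤m j) λ J≡m → ¬cons (inj₂ (inj₂ (inj₁ (refl , J≡m)))))
          where
          2≤ : ∀ n → n ≢ 0 → n ≢ 1 → 2 ≤ n
          2≤ 0             n≢0 _   = ⊥-elim (n≢0 refl)
          2≤ 1             _   n≢1 = ⊥-elim (n≢1 refl)
          2≤ (suc (suc n)) _   _   = s≤s (s≤s z≤n)

        rooted : ∀ m c → 3 ≤ m → IsCycle H∖R m c → c Fin.zero ≡ x → HasChord H∖R m c
        rooted m c 3≤m cycle c₀≡x with chordal m c 3≤m (IsCycle-H∖R cycle)
        ... | a , b , a≢b , ¬cons , e with T? (is-xy (c a) (c b))
        ...   | no ¬xy = a , b , a≢b , ¬cons , kept e ¬xy
        ...   | yes xy with is-xy-cases _ _ xy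
        ...     | inj₁ (ca≡x , cb≡y) with proj₁ cycle (trans ca≡x (sym c₀≡x))
        ...       | refl = through cycle c₀≡x b cb≡y (a≢b ∘ sym) ¬cons
        rooted m c 3≤m cycle c₀≡x | a , b , a≢b , ¬cons , e | yes xy | inj₂ (ca≡y , cb≡x) with proj₁ cycle (trans cb≡x (sym c₀≡x))
        ...       | refl = through cycle c₀≡x a ca≡y a≢b (¬cons ∘ CycConsec-sym _ _)

    -- Otherwise H without the edge xy would be a smaller triangulation.
    nonedge-shared : ∀ {x y} → T (Ω x) → T (Ω y) → x ≢ y → ¬ T (adj M x y) → ¬ ¬ SharedComponent x y
    nonedge-shared {x} {y} x∈Ω y∈Ω x≢y ¬x-y unshared =
      minimal-triangulation-keeps-edges {M = M} minimal chordal-H∖R M⊆H∖R x y (Ω-clique x y x∈Ω y∈Ω x≢y) (is-xy-intro (inj₁ (refl , refl)))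
      where
      open NonEdge x∈Ω y∈Ω x≢y ¬x-y unshared
      open EdgeDeletion H is-xy is-xy-sym

-- Finite subsets

∈-remove : ∀ {n} {p : Subset n} {i a} → i ∈ p → i ≢ a → i ∈ p - a
∈-remove {a = a} i∈p i≢a = x∈p∧x∉q⇒x∈p─q i∈p (i≢a ∘ x∈⁅y⁆⇒x≡y a)

Tagged : ∀ {n} → Subset n → Subset n → Bool × Fin n → Set
Tagged p q (true  , i) = i ∈ p
Tagged p q (false , i) = i ∈ q

length-tagged : ∀ {n} (p q : Subset n) (ks : List (Bool × Fin n)) →
  AllPairs _≢_ ks → All (Tagged p q) ks → length ks ≤ ∣ p ∣ + ∣ q ∣
length-tagged p q []                 _                 _            = z≤n
length-tagged p q ((true , a) ∷ ks)  (a≢ks ∷ distinct) (a∈p ∷ ks∈) =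
  ≤-trans (s≤s (length-tagged (p - a) q ks distinct (All.zipWith shrink (a≢ks , ks∈))))
          (+-monoˡ-≤ ∣ q ∣ (x∈p⇒∣p-x∣<∣p∣ a∈p))
  where
  shrink : ∀ {k} → (true , a) ≢ k × Tagged p q k → Tagged (p - a) q k
  shrink {true  , i} (≢ , i∈p) = ∈-remove i∈p (≢ ∘ cong (true ,_) ∘ sym)
  shrink {false , i} (_ , i∈q) = i∈q
length-tagged p q ((false , a) ∷ ks) (a≢ks ∷ distinct) (a∈q ∷ ks∈) =
  ≤-trans (s≤s (length-tagged p (q - a) ks distinct (All.zipWith shrink (a≢ks , ks∈))))
          (≤-trans (≤-reflexive (sym (+-suc ∣ p ∣ ∣ q - a ∣))) (+-monoʳ-≤ ∣ p ∣ (x∈p⇒∣p-x∣<∣p∣ a∈q)))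
  where
  shrink : ∀ {k} → (false , a) ≢ k × Tagged p q k → Tagged p (q - a) k
  shrink {true  , i} (_ , i∈p) = i∈p
  shrink {false , i} (≢ , i∈q) = ∈-remove i∈q (≢ ∘ cong (false ,_) ∘ sym)

subsets : ∀ n → List (Subset n)
subsets zero    = [] ∷ []
subsets (suc n) = map (true ∷_) (subsets n) ++ map (false ∷_) (subsets n)

∈-subsets : ∀ {n} (X : Subset n) → X ∈ˡ subsets n
∈-subsets []                  = here refl
∈-subsets (true ∷ X)          = ∈-++⁺ˡ (∈-map⁺ (true ∷_) (∈-subsets X))
∈-subsets {suc n} (false ∷ X) = ∈-++⁺ʳ (map (true ∷_) (subsets n)) (∈-map⁺ (false ∷_) (∈-subsets X))

∈⇒T : ∀ {n} {i : Fin n} {X : Subset n} → i ∈ X → T (Data.Vec.lookup X i)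
∈⇒T i∈X rewrite Vec.[]=⇒lookup i∈X = tt

T⇒∈ : ∀ {n} {i : Fin n} {X : Subset n} → T (Data.Vec.lookup X i) → i ∈ X
T⇒∈ {i = i} {X} t = Vec.lookup⇒[]= i X (Equivalence.to Bool.T-≡ t)

∩-disjoint : ∀ {n} {X Y : Subset n} {i} → X ∩ Y ≡ ⊥ → i ∈ X → i ∈ Y → Empty.⊥
∩-disjoint {i = i} X∩Y≡⊥ i∈X i∈Y = ∉⊥ (subst (i ∈_) X∩Y≡⊥ (x∈p∩q⁺ (i∈X , i∈Y)))

-- The graph M(G, V_k)

module Application {n : ℕ} (G : Graph (Fin n)) (Vk : Subset n) (cover : IsVertexCover G Vk) where

  V : Set
  V = MVertex Vk

  M : Graph V
  M = MGraph G Vk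

  _≟_ : DecidableEquality V
  _≟_ = Sum.≡-dec Fin._≟_ (Product.≡-dec (Vec.≡-dec Bool._≟_) (Product.≡-dec T-≟ T-≟))
    where
    T-≟ : ∀ {b} → DecidableEquality (T b)
    T-≟ p q = yes (T-irrelevant p q)

  MX-of : Subset n → List (MXVertex Vk)
  MX-of X with T? (isYes (nonempty? X)) | T? (isYes (X ⊆? Vk))
  ... | yes p | yes q = (X , p , q) ∷ []
  ... | _     | _     = []

  ∈-MX-of : ∀ (x : MXVertex Vk) → x ∈ˡ MX-of (proj₁ x)
  ∈-MX-of (X , p , q) with T? (isYes (nonempty? X)) | T? (isYes (X ⊆? Vk))
  ... | yes p′ | yes q′ = here (cong (X ,_) (cong₂ _,_ (T-irrelevant p p′) (T-irrelevant q q′)))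
  ... | no ¬p  | _      = ⊥-elim (¬p p)
  ... | yes _  | no ¬q  = ⊥-elim (¬q q)

  vertices : List V
  vertices = map inj₁ (allFin n) ++ map inj₂ (concatMap MX-of (subsets n))

  ∈-vertices : ∀ v → v ∈ˡ vertices
  ∈-vertices (inj₁ i) = ∈-++⁺ˡ (∈-map⁺ inj₁ (∈-allFin i))
  ∈-vertices (inj₂ x) = ∈-++⁺ʳ (map inj₁ (allFin n))
    (∈-map⁺ inj₂ (∈-concatMap⁺ MX-of (Any.map (λ { refl → ∈-MX-of x }) (∈-subsets (proj₁ x)))))

  N : V → Subset n
  N (inj₁ i)       = tabulate (adj G i)
  N (inj₂ (X , _)) = X

  N⇒adj : ∀ v {j} → j ∈ N v → T (adj M v (inj₁ j))
  N⇒adj (inj₁ i) {j} j∈N = subst T (Vec.lookup∘tabulate (adj G i) j) (∈⇒T j∈N)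
  N⇒adj (inj₂ _)     j∈N = ∈⇒T j∈N

  adj⇒N : ∀ v {j} → T (adj M v (inj₁ j)) → j ∈ N v
  adj⇒N (inj₁ i) {j} e = T⇒∈ (subst T (sym (Vec.lookup∘tabulate (adj G i) j)) e)
  adj⇒N (inj₂ _)     e = T⇒∈ e

  Independent : V → Set
  Independent (inj₁ i) = ¬ (i ∈ Vk)
  Independent (inj₂ _) = ⊤

  N⊆Vk : ∀ v → Independent v → N v ⊆ Vk
  N⊆Vk (inj₁ i)           i∉Vk {j} j∈N with cover i j (N⇒adj (inj₁ i) j∈N)
  ... | inj₁ i∈Vk = ⊥-elim (i∉Vk i∈Vk)
  ... | inj₂ j∈Vk = j∈Vk
  N⊆Vk (inj₂ (X , _ , q)) _    j∈X = toWitness q j∈X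

  independent-adj : ∀ v w → Independent v → T (adj M v w) → ∃[ j ] (w ≡ inj₁ j × j ∈ N v)
  independent-adj (inj₁ i) (inj₁ j)           _    e = j , refl , adj⇒N (inj₁ i) e
  independent-adj (inj₁ i) (inj₂ (Y , _ , q)) i∉Vk e = ⊥-elim (i∉Vk (toWitness q (T⇒∈ e)))
  independent-adj (inj₂ _) (inj₁ j)           _    e = j , refl , T⇒∈ e

  independent-nonadjacent : ∀ u v → Independent u → Independent v → ¬ T (adj M u v)
  independent-nonadjacent u v u-ind v-ind e with independent-adj u v u-ind e
  ... | j , refl , j∈N = v-ind (N⊆Vk u u-ind j∈N)

  Meets : Subset n → Subset n → Set
  Meets X P = Nonempty (X ∩ P)

  meets : Subset n → Subset n → Bool
  meets X P = isYes (nonempty? (X ∩ P))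

  meets-intro : ∀ {X P j} → j ∈ X → j ∈ P → Meets X P
  meets-intro {j = j} j∈X j∈P = j , x∈p∩q⁺ (j∈X , j∈P)

  meets-elim : ∀ {X P} → Meets X P → ∃[ j ] (j ∈ X × j ∈ P)
  meets-elim {X} {P} (j , j∈X∩P) = j , x∈p∩q⁻ X P j∈X∩P

  body : Subset n → Subset n → Fin n → Subset n → Bool
  body P Q a X = meets X P ∧ (meets X Q ∨ isYes (a ∈? X))

  shape : Subset n → Subset n → Subset n → Fin n → VSet V
  shape A P Q a (inj₁ i) with i ∈? Vk
  ... | yes _ = isYes (i ∈? A)
  ... | no _  = body P Q a (N (inj₁ i))
  shape A P Q a (inj₂ x) = body P Q a (N (inj₂ x))

  PartitionIs-swap : ∀ {Ω A P Q} → PartitionIs G Vk Ω A P Q → PartitionIs G Vk Ω A Q P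
  PartitionIs-swap (traceA , alternatives , componentP , componentQ) =
    traceA , (λ C C-component meets-Vk → Data.Sum.swap (alternatives C C-component meets-Vk)) , componentQ , componentP

  module Side (Ω : VSet V) (pmc : IsPMC M Ω) (free : IsFree M Ω) {A P Q : Subset n}
              (A∩P≡⊥ : A ∩ P ≡ ⊥) (A∩Q≡⊥ : A ∩ Q ≡ ⊥) (P∩Q≡⊥ : P ∩ Q ≡ ⊥) (A∪P∪Q≡Vk : A ∪ (P ∪ Q) ≡ Vk)
              (P-nonempty : Nonempty P) (partition : PartitionIs G Vk Ω A P Q) where

    open MinimalTriangulation _≟_ vertices ∈-vertices M (proj₁ pmc) Ω (proj₁ (proj₂ pmc)) (proj₂ (proj₂ pmc))

    traceA : TraceEq {Vk = Vk} Vk Ω A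
    traceA = proj₁ partition

    CP CQ : VSet V
    CP = proj₁ (proj₁ (proj₂ (proj₂ partition)))
    CQ = proj₁ (proj₂ (proj₂ (proj₂ partition)))

    CP-component : IsComponent M Ω CP
    CP-component = proj₁ (proj₂ (proj₁ (proj₂ (proj₂ partition))))

    CQ-component : IsComponent M Ω CQ
    CQ-component = proj₁ (proj₂ (proj₂ (proj₂ (proj₂ partition))))

    traceP : TraceEq {Vk = Vk} Vk CP P
    traceP = proj₂ (proj₂ (proj₁ (proj₂ (proj₂ partition))))

    traceQ : TraceEq {Vk = Vk} Vk CQ Q
    traceQ = proj₂ (proj₂ (proj₂ (proj₂ (proj₂ partition))))

    Vk-cases : ∀ {i} → i ∈ Vk → i ∈ A ⊎ i ∈ P ⊎ i ∈ Q
    Vk-cases {i} i∈Vk with x∈p∪q⁻ A (P ∪ Q) (subst (i ∈_) (sym A∪P∪Q≡Vk) i∈Vk)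
    ... | inj₁ i∈A   = inj₁ i∈A
    ... | inj₂ i∈P∪Q = inj₂ (x∈p∪q⁻ P Q i∈P∪Q)

    A⊆Vk : A ⊆ Vk
    A⊆Vk i∈A = subst (_ ∈_) A∪P∪Q≡Vk (p⊆p∪q (P ∪ Q) i∈A)

    P⊆Vk : P ⊆ Vk
    P⊆Vk i∈P = subst (_ ∈_) A∪P∪Q≡Vk (x∈p∪q⁺ (inj₂ (x∈p∪q⁺ (inj₁ i∈P))))

    A⇒Ω : ∀ {i} → i ∈ A → T (Ω (inj₁ i))
    A⇒Ω {i} i∈A = proj₂ (proj₂ (traceA i) i∈A)

    Ω⇒A : ∀ {i} → i ∈ Vk → T (Ω (inj₁ i)) → i ∈ A
    Ω⇒A {i} i∈Vk i∈Ω = proj₁ (traceA i) (i∈Vk , i∈Ω)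

    P⇒CP : ∀ {i} → i ∈ P → T (CP (inj₁ i))
    P⇒CP {i} i∈P = proj₂ (proj₂ (traceP i) i∈P)

    Q⇒CQ : ∀ {i} → i ∈ Q → T (CQ (inj₁ i))
    Q⇒CQ {i} i∈Q = proj₂ (proj₂ (traceQ i) i∈Q)

    CP⇒P : ∀ {i} → i ∈ Vk → T (CP (inj₁ i)) → i ∈ P
    CP⇒P {i} i∈Vk i∈CP = proj₁ (traceP i) (i∈Vk , i∈CP)

    enter : ∀ {R C} → IsComponent M Ω C → (∀ {i} → i ∈ R → T (C (inj₁ i))) →
      ∀ v → Meets (N v) R → ¬ T (Ω v) → T (C v)
    enter {C = C} C-component R⇒C v meets-R v∉Ω =
      let j , j∈N , j∈R = meets-elim meets-R
      in Component.closed C C-component (R⇒C j∈R) v∉Ω (subst T (Graph.sym M v (inj₁ j)) (N⇒adj v j∈N))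

    outside-neighbour : ∀ v → Independent v → ∀ {c} → ¬ T (Ω c) → T (adj M c v) →
      ∃[ j ] (c ≡ inj₁ j × j ∈ N v × (j ∈ P ⊎ j ∈ Q))
    outside-neighbour v v-ind {c} c∉Ω e with independent-adj v c v-ind (subst T (Graph.sym M c v) e)
    ... | j , refl , j∈N with Vk-cases (N⊆Vk v v-ind j∈N)
    ...   | inj₁ j∈A   = ⊥-elim (c∉Ω (A⇒Ω j∈A))
    ...   | inj₂ j∈P⊎Q = j , refl , j∈N , j∈P⊎Q

    meets-both⇒Ω : ∀ v → Independent v → Meets (N v) P → Meets (N v) Q → T (Ω v)
    meets-both⇒Ω v v-ind meets-P meets-Q = T-stable λ v∉Ω →
      let q , q∈N , q∈Q = meets-elim meets-Q
          q∈Vk = N⊆Vk v v-ind q∈N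
          q∉Ω = λ q∈Ω → ∩-disjoint A∩Q≡⊥ (Ω⇒A q∈Vk q∈Ω) q∈Q
          q∈CP = Component.closed CP CP-component (enter CP-component P⇒CP v meets-P v∉Ω) q∉Ω (N⇒adj v q∈N)
      in ∩-disjoint P∩Q≡⊥ (CP⇒P q∈Vk q∈CP) q∈Q

    meets-neither⇒∉Ω : ∀ v → Independent v → ¬ Meets (N v) P → ¬ Meets (N v) Q → ¬ T (Ω v)
    meets-neither⇒∉Ω v v-ind ¬meets-P ¬meets-Q v∈Ω =
      let w , w∉Ω , v-w = free v v∈Ω
          j , _ , j∈N , j∈P⊎Q = outside-neighbour v v-ind (T-not-elim w∉Ω) (subst T (Graph.sym M v w) v-w)
      in [ ¬meets-P ∘ meets-intro j∈N , ¬meets-Q ∘ meets-intro j∈N ] j∈P⊎Q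

    -- An independent vertex outside Ω with no neighbour in P or Q has all its neighbours in A ⊆ Ω.
    singleton-component : ∀ u → Independent u → ¬ T (Ω u) → ¬ Meets (N u) P → ¬ Meets (N u) Q →
      IsComponent M Ω (λ w → isYes (w ≟ u))
    singleton-component u u-ind u∉Ω ¬meets-P ¬meets-Q =
      (u , fromWitness refl) ,
      (λ v v≡u → subst (T ∘ not ∘ Ω) (sym (toWitness v≡u)) (T-not-intro u∉Ω)) ,
      (λ v w v≡u w≡u → subst₂ (Walk M Ω) (sym (toWitness v≡u)) (sym (toWitness w≡u)) (here (T-not-intro u∉Ω))) ,
      λ v w v≡u w∉Ω v-w → ⊥-elim (isolated (subst (λ z → T (adj M z w)) (toWitness v≡u) v-w) (T-not-elim w∉Ω))
      where
      isolated : ∀ {w} → T (adj M u w) → ¬ ¬ T (Ω w)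
      isolated {w} u-w w∉Ω =
        let j , _ , j∈N , j∈P⊎Q = outside-neighbour u u-ind w∉Ω (subst T (Graph.sym M u w) u-w)
        in [ ¬meets-P ∘ meets-intro j∈N , ¬meets-Q ∘ meets-intro j∈N ] j∈P⊎Q

    independent-component : ∀ u → Independent u → ¬ T (Ω u) → ∃[ C ] (IsComponent M Ω C × T (C u))
    independent-component u u-ind u∉Ω with nonempty? (N u ∩ P) | nonempty? (N u ∩ Q)
    ... | yes meets-P | _           = CP , CP-component , enter CP-component P⇒CP u meets-P u∉Ω
    ... | no _        | yes meets-Q = CQ , CQ-component , enter CQ-component Q⇒CQ u meets-Q u∉Ω
    ... | no ¬meets-P | no ¬meets-Q = _ , singleton-component u u-ind u∉Ω ¬meets-P ¬meets-Q , fromWitness refl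

    component-of : ∀ u → ¬ T (Ω u) → ∃[ C ] (IsComponent M Ω C × T (C u))
    component-of (inj₂ x) u∉Ω = independent-component (inj₂ x) tt u∉Ω
    component-of (inj₁ i) u∉Ω with i ∈? Vk
    ... | no i∉Vk = independent-component (inj₁ i) i∉Vk u∉Ω
    ... | yes i∈Vk with Vk-cases i∈Vk
    ...   | inj₁ i∈A        = ⊥-elim (u∉Ω (A⇒Ω i∈A))
    ...   | inj₂ (inj₁ i∈P) = CP , CP-component , P⇒CP i∈P
    ...   | inj₂ (inj₂ i∈Q) = CQ , CQ-component , Q⇒CQ i∈Q

    open Separation component-of

    Hidden : Fin n → Set
    Hidden a = ¬ Neighbour CP (inj₁ a)

    ∃-hidden? : Dec (∃[ a ] (a ∈ A × Hidden a))
    ∃-hidden? = any? λ a → (a ∈? A) ×-dec ¬? (Component.Neighbour? CP CP-component (inj₁ a))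

    meets-P-and-hidden⇒Ω : ∀ v {a} → Meets (N v) P → a ∈ N v → Hidden a → T (Ω v)
    meets-P-and-hidden⇒Ω v meets-P a∈N hidden =
      T-stable λ v∉Ω → hidden (v , enter CP-component P⇒CP v meets-P v∉Ω , N⇒adj v a∈N)

    -- A component adjacent to v reaches it through P (not Q), so it is CP, which misses a.
    Ω-without-Q⇒sees-hidden : ∀ v {a} → Independent v → ¬ Meets (N v) Q → T (Ω v) → a ∈ A → Hidden a → a ∈ N v
    Ω-without-Q⇒sees-hidden v {a} v-ind ¬meets-Q v∈Ω a∈A hidden = decidable-stable (a ∈? N v) λ a∉N →
      nonedge-shared v∈Ω (A⇒Ω a∈A) (λ v≡a → subst Independent v≡a v-ind (A⊆Vk a∈A)) (a∉N ∘ adj⇒N v) unshared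
      where
      unshared : ¬ SharedComponent v (inj₁ a)
      unshared (C , C-component , (c , c∈C , c-v) , (c′ , c′∈C , c′-a))
        with outside-neighbour v v-ind (Component.outside-Ω C C-component c∈C) c-v
      ... | j , refl , j∈N , inj₂ j∈Q = ¬meets-Q (meets-intro j∈N j∈Q)
      ... | j , refl , j∈N , inj₁ j∈P =
            hidden (c′ , Component.absorbs CP CP-component C-component c∈C (P⇒CP j∈P) c′∈C , c′-a)

    no-opposite-pair : ∀ u v → Independent u → Independent v → Meets (N u) P → ¬ Meets (N u) Q →
      Meets (N v) Q → ¬ Meets (N v) P → T (Ω u) → T (Ω v) → Empty.⊥
    no-opposite-pair u v u-ind v-ind meets-uP ¬meets-uQ meets-vQ ¬meets-vP u∈Ω v∈Ω =
      nonedge-shared u∈Ω v∈Ω (λ { refl → ¬meets-uQ meets-vQ }) (independent-nonadjacent u v u-ind v-ind) unshared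
      where
      unshared : ¬ SharedComponent u v
      unshared (C , C-component , (c , c∈C , c-u) , (c′ , c′∈C , c′-v))
        with outside-neighbour u u-ind (Component.outside-Ω C C-component c∈C) c-u
           | outside-neighbour v v-ind (Component.outside-Ω C C-component c′∈C) c′-v
      ... | j , refl , j∈N , inj₂ j∈Q | _                           = ¬meets-uQ (meets-intro j∈N j∈Q)
      ... | _                         | j′ , refl , j′∈N , inj₁ j′∈P = ¬meets-vP (meets-intro j′∈N j′∈P)
      ... | j , refl , _ , inj₁ j∈P   | j′ , refl , j′∈N , inj₂ j′∈Q
        with proj₁ (proj₂ partition) C C-component (j , P⊆Vk j∈P , c∈C)
      ...   | inj₁ C-traces-P = ∩-disjoint P∩Q≡⊥ (proj₁ (C-traces-P j′) (N⊆Vk v v-ind j′∈N , c′∈C)) j′∈Q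
      ...   | inj₂ C-traces-Q = ∩-disjoint P∩Q≡⊥ j∈P (proj₁ (C-traces-Q j) (P⊆Vk j∈P , c∈C))

    -- The vertex M_{a,p}, for some p ∈ P, lies in Ω and would be opposite to v.
    meets-only-Q⇒∉Ω : ∀ v {a} → Independent v → Meets (N v) Q → ¬ Meets (N v) P → a ∈ A → Hidden a → ¬ T (Ω v)
    meets-only-Q⇒∉Ω v {a} v-ind meets-Q ¬meets-P a∈A hidden v∈Ω =
      no-opposite-pair u v tt v-ind meets-uP ¬meets-uQ meets-Q ¬meets-P
                       (meets-P-and-hidden⇒Ω u meets-uP a∈X hidden) v∈Ω
      where
      p : Fin n
      p = proj₁ P-nonempty
      X : Subset n
      X = ⁅ a ⁆ ∪ ⁅ p ⁆
      X-cases : ∀ {j} → j ∈ X → j ≡ a ⊎ j ≡ p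
      X-cases j∈X = Data.Sum.map (x∈⁅y⁆⇒x≡y a) (x∈⁅y⁆⇒x≡y p) (x∈p∪q⁻ ⁅ a ⁆ ⁅ p ⁆ j∈X)
      a∈X : a ∈ X
      a∈X = x∈p∪q⁺ (inj₁ (x∈⁅x⁆ a))
      X⊆Vk : X ⊆ Vk
      X⊆Vk j∈X with X-cases j∈X
      ... | inj₁ refl = A⊆Vk a∈A
      ... | inj₂ refl = P⊆Vk (proj₂ P-nonempty)
      u : V
      u = inj₂ (X , fromWitness (a , a∈X) , fromWitness (λ {j} → X⊆Vk {j}))
      meets-uP : Meets X P
      meets-uP = meets-intro (x∈p∪q⁺ (inj₂ (x∈⁅x⁆ p))) (proj₂ P-nonempty)
      ¬meets-uQ : ¬ Meets X Q
      ¬meets-uQ meets-uQ with meets-elim meets-uQ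
      ... | j , j∈X , j∈Q with X-cases j∈X
      ...   | inj₁ refl = ∩-disjoint A∩Q≡⊥ a∈A j∈Q
      ...   | inj₂ refl = ∩-disjoint P∩Q≡⊥ (proj₂ P-nonempty) j∈Q

    module _ {a} (a∈A : a ∈ A) (hidden : Hidden a) where

      Ω≡body : ∀ v → Independent v → Ω v ≡ body P Q a (N v)
      Ω≡body v v-ind = T-extensional Ω⇒body body⇒Ω
        where
        Ω⇒body : T (Ω v) → T (body P Q a (N v))
        Ω⇒body v∈Ω with nonempty? (N v ∩ P) | nonempty? (N v ∩ Q)
        ... | yes _       | yes _       = tt
        ... | yes _       | no ¬meets-Q = fromWitness (Ω-without-Q⇒sees-hidden v v-ind ¬meets-Q v∈Ω a∈A hidden)
        ... | no ¬meets-P | yes meets-Q = meets-only-Q⇒∉Ω v v-ind meets-Q ¬meets-P a∈A hidden v∈Ω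
        ... | no ¬meets-P | no ¬meets-Q = meets-neither⇒∉Ω v v-ind ¬meets-P ¬meets-Q v∈Ω
        body⇒Ω : T (body P Q a (N v)) → T (Ω v)
        body⇒Ω t with nonempty? (N v ∩ P) | nonempty? (N v ∩ Q) | a ∈? N v
        ... | yes meets-P | yes meets-Q | _       = meets-both⇒Ω v v-ind meets-P meets-Q
        ... | yes meets-P | no _        | yes a∈N = meets-P-and-hidden⇒Ω v meets-P a∈N hidden
        ... | yes _       | no _        | no _    = ⊥-elim t
        ... | no _        | _           | _       = ⊥-elim t

      Ω≡shape : ∀ v → Ω v ≡ shape A P Q a v
      Ω≡shape (inj₂ x) = Ω≡body (inj₂ x) tt
      Ω≡shape (inj₁ i) with i ∈? Vk
      ... | yes i∈Vk = T-extensional (fromWitness ∘ Ω⇒A i∈Vk) (A⇒Ω ∘ toWitness)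
      ... | no i∉Vk  = Ω≡body (inj₁ i) i∉Vk

    -- If CP saw all of A it would be a full component, unless some independent vertex of Ω sees only Q.
    hidden-or-opposite : ¬ (∃[ a ] (a ∈ A × Hidden a)) →
      ¬ (∀ v → Independent v → T (Ω v) → Meets (N v) Q → ¬ Meets (N v) P → Empty.⊥)
    hidden-or-opposite none-hidden no-opposite = Component.not-full CP CP-component full
      where
      independent-full : ∀ v → Independent v → T (Ω v) → Neighbour CP v
      independent-full v v-ind v∈Ω with nonempty? (N v ∩ P) | nonempty? (N v ∩ Q)
      ... | yes meets-P | _ = let p , p∈N , p∈P = meets-elim meets-P
                              in inj₁ p , P⇒CP p∈P , subst T (Graph.sym M v (inj₁ p)) (N⇒adj v p∈N)
      ... | no ¬meets-P | yes meets-Q = ⊥-elim (no-opposite v v-ind v∈Ω meets-Q ¬meets-P)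
      ... | no ¬meets-P | no ¬meets-Q = ⊥-elim (meets-neither⇒∉Ω v v-ind ¬meets-P ¬meets-Q v∈Ω)
      full : ∀ v → T (Ω v) → Neighbour CP v
      full (inj₂ x) v∈Ω = independent-full (inj₂ x) tt v∈Ω
      full (inj₁ i) v∈Ω with i ∈? Vk
      ... | no i∉Vk  = independent-full (inj₁ i) i∉Vk v∈Ω
      ... | yes i∈Vk = decidable-stable (Component.Neighbour? CP CP-component (inj₁ i))
                                        λ hidden → none-hidden (i , Ω⇒A i∈Vk v∈Ω , hidden)

  module Classification {A P₁ P₂ : Subset n} (A∩P₁≡⊥ : A ∩ P₁ ≡ ⊥) (A∩P₂≡⊥ : A ∩ P₂ ≡ ⊥) (P₁∩P₂≡⊥ : P₁ ∩ P₂ ≡ ⊥)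
                        (A∪P₁∪P₂≡Vk : A ∪ (P₁ ∪ P₂) ≡ Vk) (P₁-nonempty : Nonempty P₁) (P₂-nonempty : Nonempty P₂) where

    shape± : Bool → Fin n → VSet V
    shape± true  = shape A P₁ P₂
    shape± false = shape A P₂ P₁

    Admissible : VSet V → Set
    Admissible Ω = IsPMC M Ω × IsFree M Ω × PartitionIs G Vk Ω A P₁ P₂

    Classified : VSet V → Set
    Classified Ω = ∃[ s ] ∃[ a ] (a ∈ A × (∀ v → Ω v ≡ shape± s a v))

    -- If neither component misses a vertex of A, each side forces an independent vertex of Ω meeting only
    -- the other part, and these two form an opposite pair.
    classify : ∀ Ω → Admissible Ω → Classified Ω
    classify Ω (pmc , free , partition) = by-cases S₁.∃-hidden? S₂.∃-hidden?
      where
      module S₁ = Side Ω pmc free A∩P₁≡⊥ A∩P₂≡⊥ P₁∩P₂≡⊥ A∪P₁∪P₂≡Vk P₁-nonempty partition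
      module S₂ = Side Ω pmc free A∩P₂≡⊥ A∩P₁≡⊥ (trans (∩-comm P₂ P₁) P₁∩P₂≡⊥)
                       (trans (cong (A ∪_) (∪-comm P₂ P₁)) A∪P₁∪P₂≡Vk) P₂-nonempty (PartitionIs-swap partition)
      by-cases : Dec (∃[ a ] (a ∈ A × S₁.Hidden a)) → Dec (∃[ a ] (a ∈ A × S₂.Hidden a)) → Classified Ω
      by-cases (yes (a , a∈A , hidden)) _                          = true , a , a∈A , S₁.Ω≡shape a∈A hidden
      by-cases (no _)                   (yes (a , a∈A , hidden)) = false , a , a∈A , S₂.Ω≡shape a∈A hidden
      by-cases (no none₁)               (no none₂)               =
        ⊥-elim (S₁.hidden-or-opposite none₁ λ v v-ind v∈Ω meets-P₂ ¬meets-P₁ →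
                  S₂.hidden-or-opposite none₂ λ w w-ind w∈Ω meets-P₁ ¬meets-P₂ →
                    S₁.no-opposite-pair w v w-ind v-ind meets-P₁ ¬meets-P₂ meets-P₂ ¬meets-P₁ w∈Ω v∈Ω)

    key : ∀ {Ω} → Admissible Ω → Bool × Fin n
    key {Ω} admissible = let s , a , _ = classify Ω admissible in s , a

    key-injective : ∀ {Ω Ω′} (admissible : Admissible Ω) (admissible′ : Admissible Ω′) →
      key admissible ≡ key admissible′ → ¬ DistinctVSet Ω Ω′
    key-injective {Ω} {Ω′} admissible admissible′ same (v , Ωv≢Ω′v)
      with classify Ω admissible | classify Ω′ admissible′
    ... | s , a , _ , Ω≡ | s′ , a′ , _ , Ω′≡ = Ωv≢Ω′v (trans (Ω≡ v) (trans (cong (λ (s , a) → shape± s a v) same) (sym (Ω′≡ v))))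

    keys : ∀ {Ωs} → All Admissible Ωs → List (Bool × Fin n)
    keys = All.reduce key

    length-keys : ∀ {Ωs} (admissible : All Admissible Ωs) → length (keys admissible) ≡ length Ωs
    length-keys []                     = refl
    length-keys (_ ∷ admissible) = cong suc (length-keys admissible)

    keys-tagged : ∀ {Ωs} (admissible : All Admissible Ωs) → All (Tagged A A) (keys admissible)
    keys-tagged []                       = []
    keys-tagged {Ω ∷ _} (adm ∷ admissible) with classify Ω adm
    ... | true  , a , a∈A , _ = a∈A ∷ keys-tagged admissible
    ... | false , a , a∈A , _ = a∈A ∷ keys-tagged admissible

    keys-distinct : ∀ {Ωs} → AllPairs DistinctVSet Ωs → (admissible : All Admissible Ωs) → AllPairs _≢_ (keys admissible)
    keys-distinct []                 []                 = []
    keys-distinct (Ω≢Ωs ∷ distinct) (adm ∷ admissible) = head Ω≢Ωs admissible ∷ keys-distinct distinct admissible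
      where
      head : ∀ {Ωs} → All (DistinctVSet _) Ωs → (admissible : All Admissible Ωs) → All (key adm ≢_) (keys admissible)
      head []          []                  = []
      head (d ∷ ds) (adm′ ∷ admissible′) = (λ same → key-injective adm adm′ same d) ∷ head ds admissible′

    count : ∀ {Ωs} → AllPairs DistinctVSet Ωs → All Admissible Ωs → length Ωs ≤ ∣ A ∣ + ∣ A ∣
    count {Ωs} distinct admissible =
      subst (_≤ ∣ A ∣ + ∣ A ∣) (length-keys admissible)
            (length-tagged A A (keys admissible) (keys-distinct distinct admissible) (keys-tagged admissible))


lemma7 : (n k : ℕ) (G : Graph (Fin n)) (Vk : Subset n) →
    IsVertexCover G Vk → ∣ Vk ∣ ≡ k →
    (A P₁ P₂ : Subset n) →
    Nonempty A → Nonempty P₁ → Nonempty P₂ →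
    A ∩ P₁ ≡ ⊥ → A ∩ P₂ ≡ ⊥ → P₁ ∩ P₂ ≡ ⊥ → A ∪ (P₁ ∪ P₂) ≡ Vk →
    (Ωs : List (VSet (MVertex Vk))) →
    AllPairs DistinctVSet Ωs →
    All (λ Ω → IsPMC (MGraph G Vk) Ω × IsFree (MGraph G Vk) Ω × PartitionIs G Vk Ω A P₁ P₂) Ωs →
    length Ωs ≤ 2 * k
lemma7 n k G Vk cover refl A P₁ P₂ _ P₁-nonempty P₂-nonempty A∩P₁≡⊥ A∩P₂≡⊥ P₁∩P₂≡⊥ A∪P₁∪P₂≡Vk Ωs distinct admissible =
  begin
    length Ωs              ≤⟨ count distinct admissible ⟩
    ∣ A ∣ + ∣ A ∣          ≤⟨ +-mono-≤ ∣A∣≤∣Vk∣ (≤-trans ∣A∣≤∣Vk∣ (≤-reflexive (sym (+-identityʳ ∣ Vk ∣)))) ⟩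
    2 * ∣ Vk ∣             ∎
  where
  open ≤-Reasoning
  open Application G Vk cover
  open Classification A∩P₁≡⊥ A∩P₂≡⊥ P₁∩P₂≡⊥ A∪P₁∪P₂≡Vk P₁-nonempty P₂-nonempty
  ∣A∣≤∣Vk∣ : ∣ A ∣ ≤ ∣ Vk ∣
  ∣A∣≤∣Vk∣ = p⊆q⇒∣p∣≤∣q∣ (λ i∈A → subst (_ ∈_) A∪P₁∪P₂≡Vk (p⊆p∪q (P₁ ∪ P₂) i∈A))
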